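{- Let $M$ be a $\lambda\mu^{\rightarrow\wedge\vee}$-term. If $M\triangleright N$, then there is a $\lambda\mu$-term $P$ such that $M^{\circ}\triangleright^*_{\beta\mu\rho\theta}P$, $N^{\circ}\triangleright^*_{\rho}P$, and the reduction $M^{\circ}\triangleright^*_{\beta\mu\rho\theta}P$ contains at least one $\triangleright_\beta$ or $\triangleright_\mu$ step.
   Context: Variables: disjoint infinite sets ${\cal V}$ (term variables) and ${\cal W}$ ($\mu$-variables), with a special $\mu$-variable $\varphi$. $\lambda\mu^{\rightarrow\wedge\vee}$-terms: $M ::= x \mid \lambda x.M \mid (M\;\varepsilon) \mid \langle M,M\rangle \mid \omega_1 M \mid \omega_2 M \mid \mu\alpha.M \mid (\alpha\; M)$, $\varepsilon ::= M \mid \pi_1 \mid \pi_2 \mid [x_1.M, x_2.M]$. $\lambda\mu$-terms: $M ::= x \mid \lambda x.M\mid (M\;M)\mid\mu\alpha.M\mid(\alpha\;M)$. $M[(\alpha\;L):=(\alpha\;(L\;\varepsilon))]$ replaces (recursively) every subterm $(\alpha\;L)$ of $M$ by $(\alpha\;(L\;\varepsilon))$. Reduction $\triangleright$ on $\lambda\mu^{\rightarrow\wedge\vee}$-terms: compatible closure of $(\lambda x.M\;N)\triangleright M[x:=N]$; $(\mu\alpha.M\;\varepsilon)\triangleright \mu\alpha.M[(\alpha\;L):=(\alpha\;(L\;\varepsilon))]$; $(\langle M_1,M_2\rangle\;\pi_i)\triangleright M_i$; $(\omega_i M\;[x_1.N_1,x_2.N_2])\triangleright N_i[x_i:=M]$;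 $((M\;[x_1.N_1,x_2.N_2])\;\varepsilon)\triangleright (M\;[x_1.(N_1\;\varepsilon),x_2.(N_2\;\varepsilon)])$. Reductions on $\lambda\mu$-terms (each the compatible closure of its rule): $\triangleright_\beta$: $(\lambda x.M\;N)\triangleright M[x:=N]$; $\triangleright_\mu$: $(\mu\alpha.M\;N)\triangleright\mu\alpha.M[(\alpha\;L):=(\alpha\;(L\;N))]$; $\triangleright_\rho$: $(\beta\;\mu\alpha.M)\triangleright M[\alpha:=\beta]$; $\triangleright_\theta$: $\mu\alpha.(\alpha\;M)\triangleright M$ if $\alpha$ is not free in $M$. $\triangleright_{\beta\mu\rho\theta}$ is the union; $^*$ denotes reflexive–transitive closure. Translation $M\mapsto M^{\circ}$: $x^{\circ}=x$; $(\lambda x.M)^{\circ}=\lambda x.M^{\circ}$; $(M\;N)^{\circ}=(M^{\circ}\;N^{\circ})$; $(\mu\alpha.M)^{\circ}=\mu\alpha.M^{\circ}$; $(\alpha\;M)^{\circ}=(\alpha\;M^{\circ})$; $\langle M,N\rangle^{\circ}=\lambda x.(x\;M^{\circ}\;N^{\circ})$; $(M\;\pi_i)^{\circ}=\mu\alpha.(\varphi\;(M^{\circ}\;\lambda x_1.\lambda x_2.\mu\gamma.(\alpha\;x_i)))$; $(M\;[x_1.N_1,x_2.N_2])^{\circ}=\mu\alpha.(\varphi\;(M^{\circ}\;\lambda x_1.\mu\gamma.(\alpha\;N_1^{\circ})\;\lambda x_2.\mu\gamma.(\alpha\;N_2^{\circ})))$; $(\omega_iM)^{\circ}=\lambda x_1.\lambda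 x_2.(x_i\;M^{\circ})$ (bound $\alpha,\gamma,x$ fresh). -}

module Defs where

-- Two separate index spaces: term variables (ℕ, constructor `var`) and
-- μ-variables.  A μ-name is either the special free μ-variable φ (which is
-- never bound: de Bruijn binders only bind indices) or a de Bruijn index.
-- "Bound variables fresh" in the translation is realised by shifting.

open import Data.Nat using (ℕ; zero; suc; _≡ᵇ_)
open import Data.Bool using (Bool; true; false; if_then_else_)
open import Data.Product using (Σ; _×_; ∃₂)
open import Data.Sum using (_⊎_)
open import Relation.Binary.Construct.Closure.ReflexiveTransitive using (Star)

data MName : Set where
  φ  : MName
  mv : ℕ → MName

isIdx : MName → ℕ → Bool
isIdx φ      k = false
isIdx (mv n) k = n ≡ᵇ k

ext : (ℕ → ℕ) → ℕ → ℕ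
ext ρ zero    = zero
ext ρ (suc n) = suc (ρ n)

mapMN : (ℕ → MName) → MName → MName
mapMN σ φ      = φ
mapMN σ (mv n) = σ n

extM : (ℕ → MName) → ℕ → MName
extM σ zero    = mv zero
extM σ (suc n) = mapMN (λ k → mv (suc k)) (σ n)

shM : ℕ → MName
shM n = mv (suc n)

-- σ with index 0 ↦ β, index (suc n) ↦ n   (used for M[α:=β] with α bound)
inst0 : MName → ℕ → MName
inst0 β zero    = β
inst0 β (suc n) = mv n

mutual
  data Term : Set where
    var  : ℕ → Term
    lam  : Term → Term
    app  : Term → Elim → Term
    pair : Term → Term → Term
    ω₁   : Term → Term
    ω₂   : Term → Term
    mu   : Term → Term              -- μα.M   (binds μ-index 0)
    nam  : MName → Term → Term

  data Elim : Set where
    arg  : Term → Elim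
    π₁   : Elim
    π₂   : Elim
    case : Term → Term → Elim       -- [x₁.N₁, x₂.N₂] (each binds term index 0)

mutual
  renT : (ℕ → ℕ) → Term → Term
  renT ρ (var x)    = var (ρ x)
  renT ρ (lam M)    = lam (renT (ext ρ) M)
  renT ρ (app M e)  = app (renT ρ M) (renTE ρ e)
  renT ρ (pair M N) = pair (renT ρ M) (renT ρ N)
  renT ρ (ω₁ M)     = ω₁ (renT ρ M)
  renT ρ (ω₂ M)     = ω₂ (renT ρ M)
  renT ρ (mu M)     = mu (renT ρ M)
  renT ρ (nam α M)  = nam α (renT ρ M)

  renTE : (ℕ → ℕ) → Elim → Elim
  renTE ρ (arg M)      = arg (renT ρ M)
  renTE ρ π₁           = π₁
  renTE ρ π₂           = π₂
  renTE ρ (case N₁ N₂) = case (renT (ext ρ) N₁) (renT (ext ρ) N₂)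

mutual
  renM : (ℕ → MName) → Term → Term
  renM σ (var x)    = var x
  renM σ (lam M)    = lam (renM σ M)
  renM σ (app M e)  = app (renM σ M) (renME σ e)
  renM σ (pair M N) = pair (renM σ M) (renM σ N)
  renM σ (ω₁ M)     = ω₁ (renM σ M)
  renM σ (ω₂ M)     = ω₂ (renM σ M)
  renM σ (mu M)     = mu (renM (extM σ) M)
  renM σ (nam α M)  = nam (mapMN σ α) (renM σ M)

  renME : (ℕ → MName) → Elim → Elim
  renME σ (arg M)      = arg (renM σ M)
  renME σ π₁           = π₁
  renME σ π₂           = π₂
  renME σ (case N₁ N₂) = case (renM σ N₁) (renM σ N₂)

exts : (ℕ → Term) → ℕ → Term
exts σ zero    = var zero
exts σ (suc n) = renT suc (σ n)

extsM : (ℕ → Term) → ℕ → Term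
extsM σ n = renM shM (σ n)

mutual
  subT : (ℕ → Term) → Term → Term
  subT σ (var x)    = σ x
  subT σ (lam M)    = lam (subT (exts σ) M)
  subT σ (app M e)  = app (subT σ M) (subTE σ e)
  subT σ (pair M N) = pair (subT σ M) (subT σ N)
  subT σ (ω₁ M)     = ω₁ (subT σ M)
  subT σ (ω₂ M)     = ω₂ (subT σ M)
  subT σ (mu M)     = mu (subT (extsM σ) M)
  subT σ (nam α M)  = nam α (subT σ M)

  subTE : (ℕ → Term) → Elim → Elim
  subTE σ (arg M)      = arg (subT σ M)
  subTE σ π₁           = π₁
  subTE σ π₂           = π₂
  subTE σ (case N₁ N₂) = case (subT (exts σ) N₁) (subT (exts σ) N₂)

sub0 : Term → ℕ → Term
sub0 N zero    = N
sub0 N (suc n) = var n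

_[0:=_] : Term → Term → Term
M [0:= N ] = subT (sub0 N) M

-- structural substitution M[(α L) := (α (L ε))], α = μ-index k
mutual
  structS : ℕ → Elim → Term → Term
  structS k ε (var x)    = var x
  structS k ε (lam M)    = lam (structS k (renTE suc ε) M)
  structS k ε (app M e)  = app (structS k ε M) (structE k ε e)
  structS k ε (pair M N) = pair (structS k ε M) (structS k ε N)
  structS k ε (ω₁ M)     = ω₁ (structS k ε M)
  structS k ε (ω₂ M)     = ω₂ (structS k ε M)
  structS k ε (mu M)     = mu (structS (suc k) (renME shM ε) M)
  structS k ε (nam α M)  =
    if isIdx α k then nam α (app (structS k ε M) ε) else nam α (structS k ε M)

  structE : ℕ → Elim → Elim → Elim
  structE k ε (arg M)      = arg (structS k ε M)
  structE k ε π₁           = π₁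
  structE k ε π₂           = π₂
  structE k ε (case N₁ N₂) =
    case (structS k (renTE suc ε) N₁) (structS k (renTE suc ε) N₂)

data Rule : Term → Term → Set where
  r-β    : ∀ M N → Rule (app (lam M) (arg N)) (M [0:= N ])
  r-μ    : ∀ M ε → Rule (app (mu M) ε) (mu (structS 0 (renME shM ε) M))
  r-π₁   : ∀ M₁ M₂ → Rule (app (pair M₁ M₂) π₁) M₁
  r-π₂   : ∀ M₁ M₂ → Rule (app (pair M₁ M₂) π₂) M₂
  r-ω₁   : ∀ M N₁ N₂ → Rule (app (ω₁ M) (case N₁ N₂)) (N₁ [0:= M ])
  r-ω₂   : ∀ M N₁ N₂ → Rule (app (ω₂ M) (case N₁ N₂)) (N₂ [0:= M ])
  r-comm : ∀ M N₁ N₂ ε →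
    Rule (app (app M (case N₁ N₂)) ε)
         (app M (case (app N₁ (renTE suc ε)) (app N₂ (renTE suc ε))))

mutual
  infix 4 _▷_ _▷E_
  data _▷_ : Term → Term → Set where
    base  : ∀ {M N} → Rule M N → M ▷ N
    c-lam : ∀ {M M'} → M ▷ M' → lam M ▷ lam M'
    c-appˡ : ∀ {M M' e} → M ▷ M' → app M e ▷ app M' e
    c-appʳ : ∀ {M e e'} → e ▷E e' → app M e ▷ app M e'
    c-pairˡ : ∀ {M M' N} → M ▷ M' → pair M N ▷ pair M' N
    c-pairʳ : ∀ {M N N'} → N ▷ N' → pair M N ▷ pair M N'
    c-ω₁  : ∀ {M M'} → M ▷ M' → ω₁ M ▷ ω₁ M'
    c-ω₂  : ∀ {M M'} → M ▷ M' → ω₂ M ▷ ω₂ M'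
    c-mu  : ∀ {M M'} → M ▷ M' → mu M ▷ mu M'
    c-nam : ∀ {α M M'} → M ▷ M' → nam α M ▷ nam α M'

  data _▷E_ : Elim → Elim → Set where
    c-arg   : ∀ {M M'} → M ▷ M' → arg M ▷E arg M'
    c-caseˡ : ∀ {N₁ N₁' N₂} → N₁ ▷ N₁' → case N₁ N₂ ▷E case N₁' N₂
    c-caseʳ : ∀ {N₁ N₂ N₂'} → N₂ ▷ N₂' → case N₁ N₂ ▷E case N₁ N₂'

data Tm : Set where
  var : ℕ → Tm
  lam : Tm → Tm
  app : Tm → Tm → Tm
  mu  : Tm → Tm
  nam : MName → Tm → Tm

renTt : (ℕ → ℕ) → Tm → Tm
renTt ρ (var x)   = var (ρ x)
renTt ρ (lam M)   = lam (renTt (ext ρ) M)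
renTt ρ (app M N) = app (renTt ρ M) (renTt ρ N)
renTt ρ (mu M)    = mu (renTt ρ M)
renTt ρ (nam α M) = nam α (renTt ρ M)

renMt : (ℕ → MName) → Tm → Tm
renMt σ (var x)   = var x
renMt σ (lam M)   = lam (renMt σ M)
renMt σ (app M N) = app (renMt σ M) (renMt σ N)
renMt σ (mu M)    = mu (renMt (extM σ) M)
renMt σ (nam α M) = nam (mapMN σ α) (renMt σ M)

extst : (ℕ → Tm) → ℕ → Tm
extst σ zero    = var zero
extst σ (suc n) = renTt suc (σ n)

subTt : (ℕ → Tm) → Tm → Tm
subTt σ (var x)   = σ x
subTt σ (lam M)   = lam (subTt (extst σ) M)
subTt σ (app M N) = app (subTt σ M) (subTt σ N)
subTt σ (mu M)    = mu (subTt (λ n → renMt shM (σ n)) M)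
subTt σ (nam α M) = nam α (subTt σ M)

sub0t : Tm → ℕ → Tm
sub0t N zero    = N
sub0t N (suc n) = var n

-- structural substitution M[(α L) := (α (L N))], α = μ-index k
structT : ℕ → Tm → Tm → Tm
structT k N (var x)   = var x
structT k N (lam M)   = lam (structT k (renTt suc N) M)
structT k N (app M L) = app (structT k N M) (structT k N L)
structT k N (mu M)    = mu (structT (suc k) (renMt shM N) M)
structT k N (nam α M) =
  if isIdx α k then nam α (app (structT k N M) N) else nam α (structT k N M)

data BetaRule : Tm → Tm → Set where
  β-rule : ∀ M N → BetaRule (app (lam M) N) (subTt (sub0t N) M)

data MuRule : Tm → Tm → Set where
  μ-rule : ∀ M N → MuRule (app (mu M) N) (mu (structT 0 (renMt shM N) M))

data RhoRule : Tm → Tm → Set where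
  ρ-rule : ∀ β M → RhoRule (nam β (mu M)) (renMt (inst0 β) M)

-- μα.(α M) ▷ M if α not free in M  (α-free-ness expressed by M being a
-- μ-shift of some term M₀, the result being M₀)
data ThetaRule : Tm → Tm → Set where
  θ-rule : ∀ M → ThetaRule (mu (nam (mv 0) (renMt shM M))) M

data Cl (R : Tm → Tm → Set) : Tm → Tm → Set where
  base   : ∀ {M N} → R M N → Cl R M N
  c-lam  : ∀ {M M'} → Cl R M M' → Cl R (lam M) (lam M')
  c-appˡ : ∀ {M M' N} → Cl R M M' → Cl R (app M N) (app M' N)
  c-appʳ : ∀ {M N N'} → Cl R N N' → Cl R (app M N) (app M N')
  c-mu   : ∀ {M M'} → Cl R M M' → Cl R (mu M) (mu M')
  c-nam  : ∀ {α M M'} → Cl R M M' → Cl R (nam α M) (nam α M')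

_▷β_ _▷μ_ _▷ρ_ _▷θ_ _▷βμρθ_ _▷βμ_ : Tm → Tm → Set
_▷β_ = Cl BetaRule
_▷μ_ = Cl MuRule
_▷ρ_ = Cl RhoRule
_▷θ_ = Cl ThetaRule
M ▷βμρθ N = (M ▷β N ⊎ M ▷μ N) ⊎ (M ▷ρ N ⊎ M ▷θ N)
M ▷βμ N = M ▷β N ⊎ M ▷μ N

_▷*βμρθ_ _▷*ρ_ : Tm → Tm → Set
_▷*βμρθ_ = Star _▷βμρθ_
_▷*ρ_ = Star _▷ρ_

_▷⁺βμ_ : Tm → Tm → Set
M ▷⁺βμ P = ∃₂ λ Q Q' → (M ▷*βμρθ Q) × (Q ▷βμ Q') × (Q' ▷*βμρθ P)

-- λx₁.λx₂.μγ.(α x_i)   (α is the μ-index 0 outside this term)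
projK : ℕ → Tm
projK x = lam (lam (mu (nam (mv 1) (var x))))

infix 30 _°
mutual
  _° : Term → Tm
  var x ° = var x
  lam M ° = lam (M °)
  app M (arg N) ° = app (M °) (N °)
  app M π₁ ° = mu (nam φ (app (renMt shM (M °)) (projK 1)))
  app M π₂ ° = mu (nam φ (app (renMt shM (M °)) (projK 0)))
  app M (case N₁ N₂) ° =
    mu (nam φ (app (app (renMt shM (M °))
                        (lam (mu (nam (mv 1) (renMt (λ n → mv (suc (suc n))) (N₁ °))))))
                   (lam (mu (nam (mv 1) (renMt (λ n → mv (suc (suc n))) (N₂ °)))))))
  pair M N ° = lam (app (app (var 0) (renTt suc (M °))) (renTt suc (N °)))
  ω₁ M ° = lam (lam (app (var 1) (renTt (λ n → suc (suc n)) (M °))))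
  ω₂ M ° = lam (lam (app (var 0) (renTt (λ n → suc (suc n)) (M °))))
  mu M ° = mu (M °)
  nam α M ° = nam α (M °)

-- Each rule of ▷ is simulated by a short λμ-reduction of the translated redex. The logical
-- redexes become β-redexes, after which μα.(φ μγ.(α M)) ▷ρ μα.(α M) ▷θ M hands back the
-- result. A μ-redex, and a commuting conversion, become μ-steps, one per argument of the
-- translated elimination, followed by a ρ-step on the name φ; this redirects α to φ with the
-- arguments appended (replace₁, replace₂). Translating the reduct instead, each translated
-- (α (L ε)) is (α μβ.(φ …)), and ρ-contracting it yields the same term, which is why the
-- reduct only needs ρ-steps to meet. Every translation context is compatible with β, μ, ρ
-- and θ, so the simulation of a rule lifts to the compatible closure.
module Submission where

open import Defs
open import Data.Product using (Σ; _×_; _,_)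
open import Data.Sum using (inj₁; inj₂)
open import Data.Nat using (ℕ; zero; suc)
open import Data.Bool using (true; false; if_then_else_; T)
open import Data.Unit using (tt)
open import Data.Nat.Properties using (≡ᵇ⇒≡)
open import Relation.Binary.PropositionalEquality
open import Relation.Binary.Construct.Closure.ReflexiveTransitive using (ε; _◅_; _◅◅_)

cong₃ : ∀ {A B C D : Set} (f : A → B → C → D) {a a' b b' c c'} →
        a ≡ a' → b ≡ b' → c ≡ c' → f a b c ≡ f a' b' c'
cong₃ f refl refl refl = refl

mapMN-fusion : ∀ {σ τ υ} → (∀ n → mapMN σ (τ n) ≡ υ n) → ∀ α → mapMN σ (mapMN τ α) ≡ mapMN υ α
mapMN-fusion h φ      = refl
mapMN-fusion h (mv n) = h n

mapMN-extM-shM : ∀ σ α → mapMN (extM σ) (mapMN shM α) ≡ mapMN shM (mapMN σ α)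
mapMN-extM-shM σ φ      = refl
mapMN-extM-shM σ (mv n) = refl

extM-fusion : ∀ {σ τ υ} → (∀ n → mapMN σ (τ n) ≡ υ n) → ∀ n → mapMN (extM σ) (extM τ n) ≡ extM υ n
extM-fusion h zero            = refl
extM-fusion {σ} {τ} h (suc n) = trans (mapMN-extM-shM σ (τ n)) (cong (mapMN shM) (h n))

renMt-fusion : ∀ {σ τ υ} → (∀ n → mapMN σ (τ n) ≡ υ n) → ∀ M → renMt σ (renMt τ M) ≡ renMt υ M
renMt-fusion h (var x)   = refl
renMt-fusion h (lam M)   = cong lam (renMt-fusion h M)
renMt-fusion h (app M N) = cong₂ app (renMt-fusion h M) (renMt-fusion h N)
renMt-fusion h (mu M)    = cong mu (renMt-fusion (extM-fusion h) M)
renMt-fusion h (nam α M) = cong₂ nam (mapMN-fusion h α) (renMt-fusion h M)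

renMt-id : ∀ {σ} → (∀ n → σ n ≡ mv n) → ∀ M → renMt σ M ≡ M
renMt-id h (var x)        = refl
renMt-id h (lam M)        = cong lam (renMt-id h M)
renMt-id h (app M N)      = cong₂ app (renMt-id h M) (renMt-id h N)
renMt-id {σ} h (mu M)     = cong mu (renMt-id extM-id M)
  where
  extM-id : ∀ n → extM σ n ≡ mv n
  extM-id zero    = refl
  extM-id (suc n) = cong (mapMN shM) (h n)
renMt-id h (nam φ M)      = cong (nam φ) (renMt-id h M)
renMt-id h (nam (mv n) M) = cong₂ nam (h n) (renMt-id h M)

renMt-inst0-shM : ∀ β M → renMt (inst0 β) (renMt shM M) ≡ M
renMt-inst0-shM β M = trans (renMt-fusion {υ = mv} (λ _ → refl) M) (renMt-id (λ _ → refl) M)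

renMt-comm : ∀ {σ τ σ' τ'} → (∀ n → mapMN τ' (σ n) ≡ mapMN σ' (τ n)) →
             ∀ M → renMt τ' (renMt σ M) ≡ renMt σ' (renMt τ M)
renMt-comm h M = trans (renMt-fusion h M) (sym (renMt-fusion (λ _ → refl) M))

renMt-shM-comm : ∀ σ M → renMt shM (renMt σ M) ≡ renMt (extM σ) (renMt shM M)
renMt-shM-comm σ = renMt-comm (λ _ → refl)

ext-fusion : ∀ {ρ τ υ} → (∀ n → ρ (τ n) ≡ υ n) → ∀ n → ext ρ (ext τ n) ≡ ext υ n
ext-fusion h zero    = refl
ext-fusion h (suc n) = cong suc (h n)

renTt-id : ∀ {ρ} → (∀ n → ρ n ≡ n) → ∀ M → renTt ρ M ≡ M
renTt-id h (var x)       = cong var (h x)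
renTt-id {ρ} h (lam M)   = cong lam (renTt-id ext-id M)
  where
  ext-id : ∀ n → ext ρ n ≡ n
  ext-id zero    = refl
  ext-id (suc n) = cong suc (h n)
renTt-id h (app M N)     = cong₂ app (renTt-id h M) (renTt-id h N)
renTt-id h (mu M)        = cong mu (renTt-id h M)
renTt-id h (nam α M)     = cong (nam α) (renTt-id h M)

renTt-fusion : ∀ {ρ τ υ} → (∀ n → ρ (τ n) ≡ υ n) → ∀ M → renTt ρ (renTt τ M) ≡ renTt υ M
renTt-fusion h (var x)   = cong var (h x)
renTt-fusion h (lam M)   = cong lam (renTt-fusion (ext-fusion h) M)
renTt-fusion h (app M N) = cong₂ app (renTt-fusion h M) (renTt-fusion h N)
renTt-fusion h (mu M)    = cong mu (renTt-fusion h M)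
renTt-fusion h (nam α M) = cong (nam α) (renTt-fusion h M)

renTt-comm : ∀ {ρ τ ρ' τ'} → (∀ n → τ' (ρ n) ≡ ρ' (τ n)) →
             ∀ M → renTt τ' (renTt ρ M) ≡ renTt ρ' (renTt τ M)
renTt-comm h M = trans (renTt-fusion h M) (sym (renTt-fusion (λ _ → refl) M))

renTt-suc-comm : ∀ ρ M → renTt suc (renTt ρ M) ≡ renTt (ext ρ) (renTt suc M)
renTt-suc-comm ρ = renTt-comm (λ _ → refl)

renTt-renMt-comm : ∀ ρ σ M → renTt ρ (renMt σ M) ≡ renMt σ (renTt ρ M)
renTt-renMt-comm ρ σ (var x)   = refl
renTt-renMt-comm ρ σ (lam M)   = cong lam (renTt-renMt-comm (ext ρ) σ M)
renTt-renMt-comm ρ σ (app M N) = cong₂ app (renTt-renMt-comm ρ σ M) (renTt-renMt-comm ρ σ N)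
renTt-renMt-comm ρ σ (mu M)    = cong mu (renTt-renMt-comm ρ (extM σ) M)
renTt-renMt-comm ρ σ (nam α M) = cong (nam _) (renTt-renMt-comm ρ σ M)

subTt-renaming : ∀ {σ ρ} → (∀ n → σ n ≡ var (ρ n)) → ∀ M → subTt σ M ≡ renTt ρ M
subTt-renaming h (var x)       = h x
subTt-renaming {σ} {ρ} h (lam M) = cong lam (subTt-renaming extst-var M)
  where
  extst-var : ∀ n → extst σ n ≡ var (ext ρ n)
  extst-var zero    = refl
  extst-var (suc n) = cong (renTt suc) (h n)
subTt-renaming h (app M N)     = cong₂ app (subTt-renaming h M) (subTt-renaming h N)
subTt-renaming h (mu M)        = cong mu (subTt-renaming (λ n → cong (renMt shM) (h n)) M)
subTt-renaming h (nam α M)     = cong (nam α) (subTt-renaming h M)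

subTt-renTt : ∀ {σ ρ τ} → (∀ n → σ (ρ n) ≡ τ n) → ∀ M → subTt σ (renTt ρ M) ≡ subTt τ M
subTt-renTt h (var x)       = h x
subTt-renTt {σ} {ρ} {τ} h (lam M) = cong lam (subTt-renTt extst-ext M)
  where
  extst-ext : ∀ n → extst σ (ext ρ n) ≡ extst τ n
  extst-ext zero    = refl
  extst-ext (suc n) = cong (renTt suc) (h n)
subTt-renTt h (app M N)     = cong₂ app (subTt-renTt h M) (subTt-renTt h N)
subTt-renTt h (mu M)        = cong mu (subTt-renTt (λ n → cong (renMt shM) (h n)) M)
subTt-renTt h (nam α M)     = cong (nam α) (subTt-renTt h M)

renTt-subTt : ∀ {ρ σ τ} → (∀ n → renTt ρ (σ n) ≡ τ n) → ∀ M → renTt ρ (subTt σ M) ≡ subTt τ M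
renTt-subTt h (var x)       = h x
renTt-subTt {ρ} {σ} {τ} h (lam M) = cong lam (renTt-subTt ext-extst M)
  where
  ext-extst : ∀ n → renTt (ext ρ) (extst σ n) ≡ extst τ n
  ext-extst zero    = refl
  ext-extst (suc n) = trans (sym (renTt-suc-comm ρ (σ n))) (cong (renTt suc) (h n))
renTt-subTt h (app M N)     = cong₂ app (renTt-subTt h M) (renTt-subTt h N)
renTt-subTt {ρ} {σ} h (mu M) =
  cong mu (renTt-subTt (λ n → trans (renTt-renMt-comm ρ shM (σ n)) (cong (renMt shM) (h n))) M)
renTt-subTt h (nam α M)     = cong (nam α) (renTt-subTt h M)

subTt-renMt : ∀ {σ τ σ₀} → (∀ n → σ n ≡ renMt τ (σ₀ n)) → ∀ M →
              subTt σ (renMt τ M) ≡ renMt τ (subTt σ₀ M)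
subTt-renMt h (var x)       = h x
subTt-renMt {σ} {τ} {σ₀} h (lam M) = cong lam (subTt-renMt extst-renMt M)
  where
  extst-renMt : ∀ n → extst σ n ≡ renMt τ (extst σ₀ n)
  extst-renMt zero    = refl
  extst-renMt (suc n) = trans (cong (renTt suc) (h n)) (renTt-renMt-comm suc τ (σ₀ n))
subTt-renMt {σ} {τ} {σ₀} h (mu M) =
  cong mu (subTt-renMt (λ n → trans (cong (renMt shM) (h n)) (renMt-shM-comm τ (σ₀ n))) M)
subTt-renMt h (app M N)     = cong₂ app (subTt-renMt h M) (subTt-renMt h N)
subTt-renMt h (nam α M)     = cong (nam _) (subTt-renMt h M)

subTt-sub0t-weaken : ∀ N M → subTt (sub0t N) (renTt suc M) ≡ M
subTt-sub0t-weaken N M =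
  trans (subTt-renTt {τ = var} (λ _ → refl) M)
        (trans (subTt-renaming {ρ = λ n → n} (λ _ → refl) M) (renTt-id (λ _ → refl) M))

MapsIdx : (ℕ → MName) → ℕ → ℕ → Set
MapsIdx σ k k' = ∀ n → isIdx (σ n) k' ≡ isIdx (mv n) k

Avoids : (ℕ → MName) → ℕ → Set
Avoids τ k = ∀ n → isIdx (τ n) k ≡ false

isIdx-shM : ∀ α j → isIdx (mapMN shM α) (suc j) ≡ isIdx α j
isIdx-shM φ      j = refl
isIdx-shM (mv n) j = refl

isIdx-mapMN : ∀ {σ k k'} → MapsIdx σ k k' → ∀ α → isIdx (mapMN σ α) k' ≡ isIdx α k
isIdx-mapMN h φ      = refl
isIdx-mapMN h (mv n) = h n

MapsIdx-extM : ∀ {σ k k'} → MapsIdx σ k k' → MapsIdx (extM σ) (suc k) (suc k')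
MapsIdx-extM h zero        = refl
MapsIdx-extM {σ} h (suc n) = trans (isIdx-shM (σ n) _) (h n)

Avoids-extM : ∀ {τ k} → Avoids τ k → Avoids (extM τ) (suc k)
Avoids-extM h zero        = refl
Avoids-extM {τ} h (suc n) = trans (isIdx-shM (τ n) _) (h n)

structT-renMt : ∀ {σ k k' N N'} → MapsIdx σ k k' → N' ≡ renMt σ N →
                ∀ M → structT k' N' (renMt σ M) ≡ renMt σ (structT k N M)
structT-renMt h e (var x)   = refl
structT-renMt {σ} {N = N} h e (lam M) =
  cong lam (structT-renMt h (trans (cong (renTt suc) e) (renTt-renMt-comm suc σ N)) M)
structT-renMt h e (app M L) = cong₂ app (structT-renMt h e M) (structT-renMt h e L)
structT-renMt {σ} {N = N} h e (mu M) =
  cong mu (structT-renMt (MapsIdx-extM h) (trans (cong (renMt shM) e) (renMt-shM-comm σ N)) M)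
structT-renMt {σ} {k} {k'} h e (nam α M)
  with isIdx α k | isIdx (mapMN σ α) k' | isIdx-mapMN {σ} {k} {k'} h α
... | true  | .true  | refl = cong (nam _) (cong₂ app (structT-renMt h e M) e)
... | false | .false | refl = cong (nam _) (structT-renMt h e M)

structT-renTt : ∀ {ρ k N N'} → N' ≡ renTt ρ N →
                ∀ M → structT k N' (renTt ρ M) ≡ renTt ρ (structT k N M)
structT-renTt e (var x)   = refl
structT-renTt {ρ} {N = N} e (lam M) =
  cong lam (structT-renTt (trans (cong (renTt suc) e) (renTt-suc-comm ρ N)) M)
structT-renTt e (app M L) = cong₂ app (structT-renTt e M) (structT-renTt e L)
structT-renTt {ρ} {N = N} e (mu M) =
  cong mu (structT-renTt (trans (cong (renMt shM) e) (sym (renTt-renMt-comm ρ shM N))) M)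
structT-renTt {ρ} {k} e (nam α M) with isIdx α k
... | true  = cong (nam α) (cong₂ app (structT-renTt e M) e)
... | false = cong (nam α) (structT-renTt e M)

structT-fresh : ∀ {τ k N} → Avoids τ k → ∀ M → structT k N (renMt τ M) ≡ renMt τ M
structT-fresh h (var x)   = refl
structT-fresh h (lam M)   = cong lam (structT-fresh h M)
structT-fresh h (app M L) = cong₂ app (structT-fresh h M) (structT-fresh h L)
structT-fresh h (mu M)    = cong mu (structT-fresh (Avoids-extM h) M)
structT-fresh h (nam φ M) = cong (nam φ) (structT-fresh h M)
structT-fresh {τ} {k} h (nam (mv n) M) with isIdx (τ n) k | h n
... | false | refl = cong (nam _) (structT-fresh h M)

-- The translation commutes with renaming, substitution and structural substitution

shM₂ shM₃ shM₄ : ℕ → MName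
shM₂ n = mv (suc (suc n))
shM₃ n = mv (suc (suc (suc n)))
shM₄ n = mv (suc (suc (suc (suc n))))

wk₂ : ℕ → ℕ
wk₂ n = suc (suc n)

-- By definition (app M π₁)° = projTm (renMt shM (M °)) (projK 1) and
-- (app M (case N₁ N₂))° = caseTm (renMt shM (M °)) (nam (mv 1) (renMt shM₂ (N₁ °))) (…),
-- whose branches are branch (N₁ °) and branch (N₂ °).
projTm : Tm → Tm → Tm
projTm X K = mu (nam φ (app X K))

caseTm : Tm → Tm → Tm → Tm
caseTm X Z₁ Z₂ = mu (nam φ (app (app X (lam (mu Z₁))) (lam (mu Z₂))))

branch : Tm → Tm
branch Y = lam (mu (nam (mv 1) (renMt shM₂ Y)))

pairTm : Tm → Tm → Tm
pairTm A B = lam (app (app (var 0) A) B)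

mapMN-shM₂ : ∀ α → mapMN shM₂ α ≡ mapMN shM (mapMN shM α)
mapMN-shM₂ φ      = refl
mapMN-shM₂ (mv n) = refl

renMt-renTt-shM : ∀ X → renMt shM (renTt suc (renMt shM X)) ≡ renMt shM₂ (renTt suc X)
renMt-renTt-shM X =
  trans (cong (renMt shM) (renTt-renMt-comm suc shM X)) (renMt-fusion (λ _ → refl) (renTt suc X))

°-renT : ∀ ρ M → renT ρ M ° ≡ renTt ρ (M °)

°-renT-renMt : ∀ ρ τ M → renMt τ (renT ρ M °) ≡ renTt ρ (renMt τ (M °))
°-renT-renMt ρ τ M = trans (cong (renMt τ) (°-renT ρ M)) (sym (renTt-renMt-comm ρ τ (M °)))

°-renT-renTt : ∀ ρ {ρ' τ} → (∀ n → τ (ρ n) ≡ ρ' (τ n)) →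
               ∀ M → renTt τ (renT ρ M °) ≡ renTt ρ' (renTt τ (M °))
°-renT-renTt ρ {τ = τ} h M = trans (cong (renTt τ) (°-renT ρ M)) (renTt-comm h (M °))

°-renT ρ (var x)              = refl
°-renT ρ (lam M)              = cong lam (°-renT (ext ρ) M)
°-renT ρ (app M (arg N))      = cong₂ app (°-renT ρ M) (°-renT ρ N)
°-renT ρ (app M π₁)           = cong (λ X → projTm X (projK 1)) (°-renT-renMt ρ shM M)
°-renT ρ (app M π₂)           = cong (λ X → projTm X (projK 0)) (°-renT-renMt ρ shM M)
°-renT ρ (app M (case N₁ N₂)) =
  cong₃ (λ X Y₁ Y₂ → caseTm X (nam (mv 1) Y₁) (nam (mv 1) Y₂))
        (°-renT-renMt ρ shM M) (°-renT-renMt (ext ρ) shM₂ N₁) (°-renT-renMt (ext ρ) shM₂ N₂)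
°-renT ρ (pair M N)           = cong₂ pairTm (°-renT-renTt ρ (λ _ → refl) M) (°-renT-renTt ρ (λ _ → refl) N)
°-renT ρ (ω₁ M)               = cong (λ X → lam (lam (app (var 1) X))) (°-renT-renTt ρ (λ _ → refl) M)
°-renT ρ (ω₂ M)               = cong (λ X → lam (lam (app (var 0) X))) (°-renT-renTt ρ (λ _ → refl) M)
°-renT ρ (mu M)               = cong mu (°-renT ρ M)
°-renT ρ (nam α M)            = cong (nam α) (°-renT ρ M)

°-renM : ∀ σ M → renM σ M ° ≡ renMt σ (M °)

°-renM-renMt : ∀ σ {σ' τ} → (∀ n → mapMN τ (σ n) ≡ mapMN σ' (τ n)) →
               ∀ M → renMt τ (renM σ M °) ≡ renMt σ' (renMt τ (M °))
°-renM-renMt σ {τ = τ} h M = trans (cong (renMt τ) (°-renM σ M)) (renMt-comm h (M °))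

°-renM-renTt : ∀ σ ρ M → renTt ρ (renM σ M °) ≡ renMt σ (renTt ρ (M °))
°-renM-renTt σ ρ M = trans (cong (renTt ρ) (°-renM σ M)) (renTt-renMt-comm ρ σ (M °))

°-renM σ (var x)              = refl
°-renM σ (lam M)              = cong lam (°-renM σ M)
°-renM σ (app M (arg N))      = cong₂ app (°-renM σ M) (°-renM σ N)
°-renM σ (app M π₁)           = cong (λ X → projTm X (projK 1)) (°-renM-renMt σ (λ _ → refl) M)
°-renM σ (app M π₂)           = cong (λ X → projTm X (projK 0)) (°-renM-renMt σ (λ _ → refl) M)
°-renM σ (app M (case N₁ N₂)) =
  cong₃ (λ X Y₁ Y₂ → caseTm X (nam (mv 1) Y₁) (nam (mv 1) Y₂))
        (°-renM-renMt σ (λ _ → refl) M)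
        (°-renM-renMt σ (λ n → mapMN-shM₂ (σ n)) N₁) (°-renM-renMt σ (λ n → mapMN-shM₂ (σ n)) N₂)
°-renM σ (pair M N)           = cong₂ pairTm (°-renM-renTt σ suc M) (°-renM-renTt σ suc N)
°-renM σ (ω₁ M)               = cong (λ X → lam (lam (app (var 1) X))) (°-renM-renTt σ wk₂ M)
°-renM σ (ω₂ M)               = cong (λ X → lam (lam (app (var 0) X))) (°-renM-renTt σ wk₂ M)
°-renM σ (mu M)               = cong mu (°-renM (extM σ) M)
°-renM σ (nam α M)            = cong (nam _) (°-renM σ M)

°-subT : ∀ {σ τ} → (∀ n → σ n ° ≡ τ n) → ∀ M → subT σ M ° ≡ subTt τ (M °)

°-exts : ∀ {σ τ} → (∀ n → σ n ° ≡ τ n) → ∀ n → exts σ n ° ≡ extst τ n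
°-exts h zero          = refl
°-exts {σ} h (suc n)   = trans (°-renT suc (σ n)) (cong (renTt suc) (h n))

°-subT-renMt : ∀ κ {σ : ℕ → Term} {τ υ : ℕ → Tm} → (∀ n → σ n ° ≡ τ n) → (∀ n → υ n ≡ renMt κ (τ n)) →
               ∀ M → renMt κ (subT σ M °) ≡ subTt υ (renMt κ (M °))
°-subT-renMt κ {τ = τ} h h' M = trans (cong (renMt κ) (°-subT h M)) (sym (subTt-renMt {σ₀ = τ} h' (M °)))

°-subT-renTt : ∀ κ {σ : ℕ → Term} {τ υ : ℕ → Tm} → (∀ n → σ n ° ≡ τ n) → (∀ n → υ (κ n) ≡ renTt κ (τ n)) →
               ∀ M → renTt κ (subT σ M °) ≡ subTt υ (renTt κ (M °))
°-subT-renTt κ {τ = τ} h h' M =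
  trans (cong (renTt κ) (°-subT h M))
        (trans (renTt-subTt (λ _ → refl) (M °)) (sym (subTt-renTt {τ = λ n → renTt κ (τ n)} h' (M °))))

°-subT h (var x)              = h x
°-subT h (lam M)              = cong lam (°-subT (°-exts h) M)
°-subT h (app M (arg N))      = cong₂ app (°-subT h M) (°-subT h N)
°-subT h (app M π₁)           = cong (λ X → projTm X (projK 1)) (°-subT-renMt shM h (λ _ → refl) M)
°-subT h (app M π₂)           = cong (λ X → projTm X (projK 0)) (°-subT-renMt shM h (λ _ → refl) M)
°-subT {τ = τ} h (app M (case N₁ N₂)) =
  cong₃ (λ X Y₁ Y₂ → caseTm X (nam (mv 1) Y₁) (nam (mv 1) Y₂))
        (°-subT-renMt shM h (λ _ → refl) M)
        (°-subT-renMt shM₂ (°-exts h) shift-extst N₁) (°-subT-renMt shM₂ (°-exts h) shift-extst N₂)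
  where
  shift-extst : ∀ n → renMt shM (extst (λ m → renMt shM (τ m)) n) ≡ renMt shM₂ (extst τ n)
  shift-extst zero    = refl
  shift-extst (suc n) = renMt-renTt-shM (τ n)
°-subT h (pair M N)           =
  cong₂ pairTm (°-subT-renTt suc h (λ _ → refl) M) (°-subT-renTt suc h (λ _ → refl) N)
°-subT {τ = τ} h (ω₁ M)       =
  cong (λ X → lam (lam (app (var 1) X))) (°-subT-renTt wk₂ h (λ n → renTt-fusion (λ _ → refl) (τ n)) M)
°-subT {τ = τ} h (ω₂ M)       =
  cong (λ X → lam (lam (app (var 0) X))) (°-subT-renTt wk₂ h (λ n → renTt-fusion (λ _ → refl) (τ n)) M)
°-subT {σ} h (mu M)           = cong mu (°-subT (λ n → trans (°-renM shM (σ n)) (cong (renMt shM) (h n))) M)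
°-subT h (nam α M)            = cong (nam α) (°-subT h M)

°-structS : ∀ k L M → structS k (arg L) M ° ≡ structT k (L °) (M °)

°-structS-renMt : ∀ {κ k k' L N} → MapsIdx κ k k' → N ≡ renMt κ (L °) →
                  ∀ M → renMt κ (structS k (arg L) M °) ≡ structT k' N (renMt κ (M °))
°-structS-renMt {κ} {k} {L = L} h e M =
  trans (cong (renMt κ) (°-structS k L M)) (sym (structT-renMt h e (M °)))

°-structS-renTt : ∀ {κ k L N} → N ≡ renTt κ (L °) →
                  ∀ M → renTt κ (structS k (arg L) M °) ≡ structT k N (renTt κ (M °))
°-structS-renTt {κ} {k} {L} e M =
  trans (cong (renTt κ) (°-structS k L M)) (sym (structT-renTt e (M °)))

°-structS k L (var x)              = refl
°-structS k L (lam M)              =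
  cong lam (trans (°-structS k (renT suc L) M) (cong (λ Y → structT k Y (M °)) (°-renT suc L)))
°-structS k L (app M (arg N))      = cong₂ app (°-structS k L M) (°-structS k L N)
°-structS k L (app M π₁)           = cong (λ X → projTm X (projK 1)) (°-structS-renMt (λ _ → refl) refl M)
°-structS k L (app M π₂)           = cong (λ X → projTm X (projK 0)) (°-structS-renMt (λ _ → refl) refl M)
°-structS k L (app M (case N₁ N₂)) =
  cong₃ (λ X Y₁ Y₂ → caseTm X (nam (mv 1) Y₁) (nam (mv 1) Y₂))
        (°-structS-renMt (λ _ → refl) refl M)
        (°-structS-renMt (λ _ → refl) shifted-L N₁) (°-structS-renMt (λ _ → refl) shifted-L N₂)
  where
  shifted-L : renMt shM (renTt suc (renMt shM (L °))) ≡ renMt shM₂ (renT suc L °)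
  shifted-L = trans (renMt-renTt-shM (L °)) (cong (renMt shM₂) (sym (°-renT suc L)))
°-structS k L (pair M N)           = cong₂ pairTm (°-structS-renTt refl M) (°-structS-renTt refl N)
°-structS k L (ω₁ M)               =
  cong (λ X → lam (lam (app (var 1) X))) (°-structS-renTt (renTt-fusion (λ _ → refl) (L °)) M)
°-structS k L (ω₂ M)               =
  cong (λ X → lam (lam (app (var 0) X))) (°-structS-renTt (renTt-fusion (λ _ → refl) (L °)) M)
°-structS k L (mu M)               =
  cong mu (trans (°-structS (suc k) (renM shM L) M) (cong (λ Y → structT (suc k) Y (M °)) (°-renM shM L)))
°-structS k L (nam α M) with isIdx α k
... | true  = cong (nam α) (cong₂ app (°-structS k L M) refl)
... | false = cong (nam α) (°-structS k L M)

Cl-renTt : ∀ {R} → (∀ ρ {M N} → R M N → Cl R (renTt ρ M) (renTt ρ N)) →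
           ∀ ρ {M N} → Cl R M N → Cl R (renTt ρ M) (renTt ρ N)
Cl-renTt h ρ (base r)   = h ρ r
Cl-renTt h ρ (c-lam s)  = c-lam (Cl-renTt h (ext ρ) s)
Cl-renTt h ρ (c-appˡ s) = c-appˡ (Cl-renTt h ρ s)
Cl-renTt h ρ (c-appʳ s) = c-appʳ (Cl-renTt h ρ s)
Cl-renTt h ρ (c-mu s)   = c-mu (Cl-renTt h ρ s)
Cl-renTt h ρ (c-nam s)  = c-nam (Cl-renTt h ρ s)

Cl-renMt : ∀ {R} → (∀ σ {M N} → R M N → Cl R (renMt σ M) (renMt σ N)) →
           ∀ σ {M N} → Cl R M N → Cl R (renMt σ M) (renMt σ N)
Cl-renMt h σ (base r)   = h σ r
Cl-renMt h σ (c-lam s)  = c-lam (Cl-renMt h σ s)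
Cl-renMt h σ (c-appˡ s) = c-appˡ (Cl-renMt h σ s)
Cl-renMt h σ (c-appʳ s) = c-appʳ (Cl-renMt h σ s)
Cl-renMt h σ (c-mu s)   = c-mu (Cl-renMt h (extM σ) s)
Cl-renMt h σ (c-nam s)  = c-nam (Cl-renMt h σ s)

reduct-≡ : ∀ (R : Tm → Tm → Set) {M N N'} → R M N → N ≡ N' → R M N'
reduct-≡ R r refl = r

redex-≡ : ∀ (R : Tm → Tm → Set) {M M' N} → M ≡ M' → R M' N → R M N
redex-≡ R refl r = r

β-step : ∀ M N → app (lam M) N ▷β subTt (sub0t N) M
β-step M N = base (β-rule M N)

μ-step : ∀ M N → app (mu M) N ▷μ mu (structT 0 (renMt shM N) M)
μ-step M N = base (μ-rule M N)

ρ-step : ∀ β M → nam β (mu M) ▷ρ renMt (inst0 β) M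
ρ-step β M = base (ρ-rule β M)

θ-step : ∀ M → mu (nam (mv 0) (renMt shM M)) ▷θ M
θ-step M = base (θ-rule M)

BetaRule-renTt : ∀ ρ {M N} → BetaRule M N → renTt ρ M ▷β renTt ρ N
BetaRule-renTt ρ (β-rule M N) =
  reduct-≡ _▷β_ (β-step _ _)
    (trans (subTt-renTt {τ = λ n → renTt ρ (sub0t N n)} sub0t-ext M) (sym (renTt-subTt (λ _ → refl) M)))
  where
  sub0t-ext : ∀ n → sub0t (renTt ρ N) (ext ρ n) ≡ renTt ρ (sub0t N n)
  sub0t-ext zero    = refl
  sub0t-ext (suc n) = refl

BetaRule-renMt : ∀ σ {M N} → BetaRule M N → renMt σ M ▷β renMt σ N
BetaRule-renMt σ (β-rule M N) = reduct-≡ _▷β_ (β-step _ _) (subTt-renMt sub0t-renMt M)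
  where
  sub0t-renMt : ∀ n → sub0t (renMt σ N) n ≡ renMt σ (sub0t N n)
  sub0t-renMt zero    = refl
  sub0t-renMt (suc n) = refl

MuRule-renTt : ∀ ρ {M N} → MuRule M N → renTt ρ M ▷μ renTt ρ N
MuRule-renTt ρ (μ-rule M N) =
  reduct-≡ _▷μ_ (μ-step _ _) (cong mu (structT-renTt (sym (renTt-renMt-comm ρ shM N)) M))

MuRule-renMt : ∀ σ {M N} → MuRule M N → renMt σ M ▷μ renMt σ N
MuRule-renMt σ (μ-rule M N) =
  reduct-≡ _▷μ_ (μ-step _ _) (cong mu (structT-renMt extM-MapsIdx₀ (renMt-shM-comm σ N) M))
  where
  extM-MapsIdx₀ : MapsIdx (extM σ) 0 0
  extM-MapsIdx₀ zero    = refl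
  extM-MapsIdx₀ (suc n) with σ n
  ... | φ    = refl
  ... | mv _ = refl

RhoRule-renTt : ∀ ρ {M N} → RhoRule M N → renTt ρ M ▷ρ renTt ρ N
RhoRule-renTt ρ (ρ-rule β M) = reduct-≡ _▷ρ_ (ρ-step _ _) (sym (renTt-renMt-comm ρ (inst0 β) M))

RhoRule-renMt : ∀ σ {M N} → RhoRule M N → renMt σ M ▷ρ renMt σ N
RhoRule-renMt σ (ρ-rule β M) = reduct-≡ _▷ρ_ (ρ-step _ _) (renMt-comm inst0-extM M)
  where
  inst0-extM : ∀ n → mapMN (inst0 (mapMN σ β)) (extM σ n) ≡ mapMN σ (inst0 β n)
  inst0-extM zero    = refl
  inst0-extM (suc n) with σ n
  ... | φ    = refl
  ... | mv _ = refl

ThetaRule-renTt : ∀ ρ {M N} → ThetaRule M N → renTt ρ M ▷θ renTt ρ N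
ThetaRule-renTt ρ (θ-rule M) =
  redex-≡ _▷θ_ (cong (λ X → mu (nam (mv 0) X)) (renTt-renMt-comm ρ shM M)) (θ-step _)

ThetaRule-renMt : ∀ σ {M N} → ThetaRule M N → renMt σ M ▷θ renMt σ N
ThetaRule-renMt σ (θ-rule M) =
  redex-≡ _▷θ_ (cong (λ X → mu (nam (mv 0) X)) (sym (renMt-shM-comm σ M))) (θ-step _)

record Compatible (f : Tm → Tm) : Set where
  field
    onβ : ∀ {M N} → M ▷β N → f M ▷β f N
    onμ : ∀ {M N} → M ▷μ N → f M ▷μ f N
    onρ : ∀ {M N} → M ▷ρ N → f M ▷ρ f N
    onθ : ∀ {M N} → M ▷θ N → f M ▷θ f N
open Compatible

congruence : (f : Tm → Tm) → (∀ {R M N} → Cl R M N → Cl R (f M) (f N)) → Compatible f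
congruence f h = record { onβ = h ; onμ = h ; onρ = h ; onθ = h }

lamC : Compatible lam
lamC = congruence lam c-lam

muC : Compatible mu
muC = congruence mu c-mu

namC : ∀ α → Compatible (nam α)
namC α = congruence (nam α) c-nam

appˡC : ∀ N → Compatible (λ X → app X N)
appˡC N = congruence _ c-appˡ

appʳC : ∀ M → Compatible (app M)
appʳC M = congruence _ c-appʳ

renTtC : ∀ ρ → Compatible (renTt ρ)
renTtC ρ = record
  { onβ = Cl-renTt BetaRule-renTt ρ ; onμ = Cl-renTt MuRule-renTt ρ
  ; onρ = Cl-renTt RhoRule-renTt ρ  ; onθ = Cl-renTt ThetaRule-renTt ρ }

renMtC : ∀ σ → Compatible (renMt σ)
renMtC σ = record
  { onβ = Cl-renMt BetaRule-renMt σ ; onμ = Cl-renMt MuRule-renMt σ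
  ; onρ = Cl-renMt RhoRule-renMt σ  ; onθ = Cl-renMt ThetaRule-renMt σ }

infixr 9 _∘C_
_∘C_ : ∀ {f g} → Compatible f → Compatible g → Compatible (λ X → f (g X))
F ∘C G = record
  { onβ = λ s → onβ F (onβ G s) ; onμ = λ s → onμ F (onμ G s)
  ; onρ = λ s → onρ F (onρ G s) ; onθ = λ s → onθ F (onθ G s) }

onβμρθ : ∀ {f} → Compatible f → ∀ {M N} → M ▷βμρθ N → f M ▷βμρθ f N
onβμρθ C (inj₁ (inj₁ s)) = inj₁ (inj₁ (onβ C s))
onβμρθ C (inj₁ (inj₂ s)) = inj₁ (inj₂ (onμ C s))
onβμρθ C (inj₂ (inj₁ s)) = inj₂ (inj₁ (onρ C s))
onβμρθ C (inj₂ (inj₂ s)) = inj₂ (inj₂ (onθ C s))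

onβμ : ∀ {f} → Compatible f → ∀ {M N} → M ▷βμ N → f M ▷βμ f N
onβμ C (inj₁ s) = inj₁ (onβ C s)
onβμ C (inj₂ s) = inj₂ (onμ C s)

on*βμρθ : ∀ {f} → Compatible f → ∀ {M N} → M ▷*βμρθ N → f M ▷*βμρθ f N
on*βμρθ C ε        = ε
on*βμρθ C (s ◅ ss) = onβμρθ C s ◅ on*βμρθ C ss

on*ρ : ∀ {f} → Compatible f → ∀ {M N} → M ▷*ρ N → f M ▷*ρ f N
on*ρ C ε        = ε
on*ρ C (s ◅ ss) = onρ C s ◅ on*ρ C ss

β⊆ : ∀ {M N} → M ▷β N → M ▷βμρθ N
β⊆ s = inj₁ (inj₁ s)

μ⊆ : ∀ {M N} → M ▷μ N → M ▷βμρθ N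
μ⊆ s = inj₁ (inj₂ s)

ρ⊆ : ∀ {M N} → M ▷ρ N → M ▷βμρθ N
ρ⊆ s = inj₂ (inj₁ s)

θ⊆ : ∀ {M N} → M ▷θ N → M ▷βμρθ N
θ⊆ s = inj₂ (inj₂ s)

βμ-then : ∀ {M Q P} → M ▷βμ Q → Q ▷*βμρθ P → M ▷⁺βμ P
βμ-then s ss = _ , _ , ε , s , ss

on⁺βμ : ∀ {f} → Compatible f → ∀ {M N} → M ▷⁺βμ N → f M ▷⁺βμ f N
on⁺βμ C (_ , _ , before , s , after) = _ , _ , on*βμρθ C before , onβμ C s , on*βμρθ C after

-- Redirecting a μ-name to φ

replace₁ : ℕ → Tm → Tm → Tm
replace₁ k K (var x)   = var x
replace₁ k K (lam M)   = lam (replace₁ k (renTt suc K) M)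
replace₁ k K (app M N) = app (replace₁ k K M) (replace₁ k K N)
replace₁ k K (mu M)    = mu (replace₁ (suc k) (renMt shM K) M)
replace₁ k K (nam α M) =
  if isIdx α k then nam φ (app (replace₁ k K M) K) else nam α (replace₁ k K M)

replace₂ : ℕ → Tm → Tm → Tm → Tm
replace₂ k K₁ K₂ (var x)   = var x
replace₂ k K₁ K₂ (lam M)   = lam (replace₂ k (renTt suc K₁) (renTt suc K₂) M)
replace₂ k K₁ K₂ (app M N) = app (replace₂ k K₁ K₂ M) (replace₂ k K₁ K₂ N)
replace₂ k K₁ K₂ (mu M)    = mu (replace₂ (suc k) (renMt shM K₁) (renMt shM K₂) M)
replace₂ k K₁ K₂ (nam α M) =
  if isIdx α k then nam φ (app (app (replace₂ k K₁ K₂ M) K₁) K₂) else nam α (replace₂ k K₁ K₂ M)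

replace₁-renMt : ∀ {σ k k' K K'} → MapsIdx σ k k' → K' ≡ renMt σ K →
                 ∀ M → renMt σ (replace₁ k K M) ≡ replace₁ k' K' (renMt σ M)
replace₁-renMt h e (var x)   = refl
replace₁-renMt {σ} {K = K} h e (lam M) =
  cong lam (replace₁-renMt h (trans (cong (renTt suc) e) (renTt-renMt-comm suc σ K)) M)
replace₁-renMt h e (app M N) = cong₂ app (replace₁-renMt h e M) (replace₁-renMt h e N)
replace₁-renMt {σ} {K = K} h e (mu M) =
  cong mu (replace₁-renMt (MapsIdx-extM h) (trans (cong (renMt shM) e) (renMt-shM-comm σ K)) M)
replace₁-renMt {σ} {k} {k'} h e (nam α M)
  with isIdx α k | isIdx (mapMN σ α) k' | isIdx-mapMN {σ} {k} {k'} h α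
... | true  | .true  | refl = cong (nam φ) (cong₂ app (replace₁-renMt h e M) (sym e))
... | false | .false | refl = cong (nam _) (replace₁-renMt h e M)

replace₁-renTt : ∀ {ρ k K K'} → K' ≡ renTt ρ K →
                 ∀ M → renTt ρ (replace₁ k K M) ≡ replace₁ k K' (renTt ρ M)
replace₁-renTt e (var x)   = refl
replace₁-renTt {ρ} {K = K} e (lam M) =
  cong lam (replace₁-renTt (trans (cong (renTt suc) e) (renTt-suc-comm ρ K)) M)
replace₁-renTt e (app M N) = cong₂ app (replace₁-renTt e M) (replace₁-renTt e N)
replace₁-renTt {ρ} {K = K} e (mu M) =
  cong mu (replace₁-renTt (trans (cong (renMt shM) e) (sym (renTt-renMt-comm ρ shM K))) M)
replace₁-renTt {ρ} {k} e (nam α M) with isIdx α k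
... | true  = cong (nam φ) (cong₂ app (replace₁-renTt e M) (sym e))
... | false = cong (nam α) (replace₁-renTt e M)

replace₁-fresh : ∀ {τ k K} → Avoids τ k → ∀ M → replace₁ k K (renMt τ M) ≡ renMt τ M
replace₁-fresh h (var x)   = refl
replace₁-fresh h (lam M)   = cong lam (replace₁-fresh h M)
replace₁-fresh h (app M L) = cong₂ app (replace₁-fresh h M) (replace₁-fresh h L)
replace₁-fresh h (mu M)    = cong mu (replace₁-fresh (Avoids-extM h) M)
replace₁-fresh h (nam φ M) = cong (nam φ) (replace₁-fresh h M)
replace₁-fresh {τ} {k} h (nam (mv n) M) with isIdx (τ n) k | h n
... | false | refl = cong (nam _) (replace₁-fresh h M)

replace₂-renMt : ∀ {σ k k' K₁ K₂ K₁' K₂'} → MapsIdx σ k k' → K₁' ≡ renMt σ K₁ → K₂' ≡ renMt σ K₂ →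
                 ∀ M → renMt σ (replace₂ k K₁ K₂ M) ≡ replace₂ k' K₁' K₂' (renMt σ M)
replace₂-renMt h e₁ e₂ (var x)   = refl
replace₂-renMt {σ} {K₁ = K₁} {K₂} h e₁ e₂ (lam M) =
  cong lam (replace₂-renMt h (trans (cong (renTt suc) e₁) (renTt-renMt-comm suc σ K₁))
                             (trans (cong (renTt suc) e₂) (renTt-renMt-comm suc σ K₂)) M)
replace₂-renMt h e₁ e₂ (app M N) = cong₂ app (replace₂-renMt h e₁ e₂ M) (replace₂-renMt h e₁ e₂ N)
replace₂-renMt {σ} {K₁ = K₁} {K₂} h e₁ e₂ (mu M) =
  cong mu (replace₂-renMt (MapsIdx-extM h) (trans (cong (renMt shM) e₁) (renMt-shM-comm σ K₁))
                                           (trans (cong (renMt shM) e₂) (renMt-shM-comm σ K₂)) M)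
replace₂-renMt {σ} {k} {k'} h e₁ e₂ (nam α M)
  with isIdx α k | isIdx (mapMN σ α) k' | isIdx-mapMN {σ} {k} {k'} h α
... | true  | .true  | refl =
  cong (nam φ) (cong₂ app (cong₂ app (replace₂-renMt h e₁ e₂ M) (sym e₁)) (sym e₂))
... | false | .false | refl = cong (nam _) (replace₂-renMt h e₁ e₂ M)

replace₂-renTt : ∀ {ρ k K₁ K₂ K₁' K₂'} → K₁' ≡ renTt ρ K₁ → K₂' ≡ renTt ρ K₂ →
                 ∀ M → renTt ρ (replace₂ k K₁ K₂ M) ≡ replace₂ k K₁' K₂' (renTt ρ M)
replace₂-renTt e₁ e₂ (var x)   = refl
replace₂-renTt {ρ} {K₁ = K₁} {K₂} e₁ e₂ (lam M) =
  cong lam (replace₂-renTt (trans (cong (renTt suc) e₁) (renTt-suc-comm ρ K₁))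
                           (trans (cong (renTt suc) e₂) (renTt-suc-comm ρ K₂)) M)
replace₂-renTt e₁ e₂ (app M N) = cong₂ app (replace₂-renTt e₁ e₂ M) (replace₂-renTt e₁ e₂ N)
replace₂-renTt {ρ} {K₁ = K₁} {K₂} e₁ e₂ (mu M) =
  cong mu (replace₂-renTt (trans (cong (renMt shM) e₁) (sym (renTt-renMt-comm ρ shM K₁)))
                          (trans (cong (renMt shM) e₂) (sym (renTt-renMt-comm ρ shM K₂))) M)
replace₂-renTt {ρ} {k} e₁ e₂ (nam α M) with isIdx α k
... | true  = cong (nam φ) (cong₂ app (cong₂ app (replace₂-renTt e₁ e₂ M) (sym e₁)) (sym e₂))
... | false = cong (nam α) (replace₂-renTt e₁ e₂ M)

replace₂-fresh : ∀ {τ k K₁ K₂} → Avoids τ k → ∀ M → replace₂ k K₁ K₂ (renMt τ M) ≡ renMt τ M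
replace₂-fresh h (var x)   = refl
replace₂-fresh h (lam M)   = cong lam (replace₂-fresh h M)
replace₂-fresh h (app M L) = cong₂ app (replace₂-fresh h M) (replace₂-fresh h L)
replace₂-fresh h (mu M)    = cong mu (replace₂-fresh (Avoids-extM h) M)
replace₂-fresh h (nam φ M) = cong (nam φ) (replace₂-fresh h M)
replace₂-fresh {τ} {k} h (nam (mv n) M) with isIdx (τ n) k | h n
... | false | refl = cong (nam _) (replace₂-fresh h M)

record Redirects (σ τ : ℕ → MName) (j k : ℕ) : Set where
  field
    tracks  : MapsIdx τ k j
    others  : ∀ n → isIdx (mv n) k ≡ false → mapMN σ (τ n) ≡ mv n
    target  : ∀ n → isIdx (mv n) k ≡ true → mapMN σ (τ n) ≡ φ
open Redirects

Redirects-extM : ∀ {σ τ j k} → Redirects σ τ j k → Redirects (extM σ) (extM τ) (suc j) (suc k)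
Redirects-extM {σ} {τ} {j} {k} r = record
  { tracks = MapsIdx-extM (tracks r) ; others = others' ; target = target' }
  where
  others' : ∀ n → isIdx (mv n) (suc k) ≡ false → mapMN (extM σ) (extM τ n) ≡ mv n
  others' zero    e = refl
  others' (suc n) e = trans (mapMN-extM-shM σ (τ n)) (cong (mapMN shM) (others r n e))
  target' : ∀ n → isIdx (mv n) (suc k) ≡ true → mapMN (extM σ) (extM τ n) ≡ φ
  target' zero    ()
  target' (suc n) e = trans (mapMN-extM-shM σ (τ n)) (cong (mapMN shM) (target r n e))

-- ρ-contracting (φ μα.M) renames α to φ: after a μ-step this turns structT into replace₁.
redirect-structT : ∀ {σ τ j k N K} → Redirects σ τ j k → renMt σ N ≡ K →
                   ∀ M → renMt σ (structT j N (renMt τ M)) ≡ replace₁ k K M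
redirect-structT r e (var x)   = refl
redirect-structT {σ} {N = N} r e (lam M) =
  cong lam (redirect-structT r (trans (sym (renTt-renMt-comm suc σ N)) (cong (renTt suc) e)) M)
redirect-structT r e (app M L) = cong₂ app (redirect-structT r e M) (redirect-structT r e L)
redirect-structT {σ} {N = N} r e (mu M) =
  cong mu (redirect-structT (Redirects-extM r) (trans (sym (renMt-shM-comm σ N)) (cong (renMt shM) e)) M)
redirect-structT r e (nam φ M) = cong (nam φ) (redirect-structT r e M)
redirect-structT {σ} {τ} {j} {k} r e (nam (mv n) M) with isIdx (mv n) k in ek
... | true  rewrite trans (tracks r n) ek =
  cong₂ nam (target r n ek) (cong₂ app (redirect-structT r e M) e)
... | false rewrite trans (tracks r n) ek =
  cong₂ nam (others r n ek) (redirect-structT r e M)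

redirect-structT² : ∀ {σ τ j k N₁ N₂ K₁ K₂} → Redirects σ τ j k → structT j N₂ N₁ ≡ N₁ →
                    renMt σ N₁ ≡ K₁ → renMt σ N₂ ≡ K₂ →
                    ∀ M → renMt σ (structT j N₂ (structT j N₁ (renMt τ M))) ≡ replace₂ k K₁ K₂ M
redirect-structT² r h e₁ e₂ (var x)   = refl
redirect-structT² {σ} {N₁ = N₁} {N₂} r h e₁ e₂ (lam M) =
  cong lam (redirect-structT² r (trans (structT-renTt refl N₁) (cong (renTt suc) h))
                                (trans (sym (renTt-renMt-comm suc σ N₁)) (cong (renTt suc) e₁))
                                (trans (sym (renTt-renMt-comm suc σ N₂)) (cong (renTt suc) e₂)) M)
redirect-structT² r h e₁ e₂ (app M L) =
  cong₂ app (redirect-structT² r h e₁ e₂ M) (redirect-structT² r h e₁ e₂ L)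
redirect-structT² {σ} {N₁ = N₁} {N₂} r h e₁ e₂ (mu M) =
  cong mu (redirect-structT² (Redirects-extM r)
                             (trans (structT-renMt (λ _ → refl) refl N₁) (cong (renMt shM) h))
                             (trans (sym (renMt-shM-comm σ N₁)) (cong (renMt shM) e₁))
                             (trans (sym (renMt-shM-comm σ N₂)) (cong (renMt shM) e₂)) M)
redirect-structT² r h e₁ e₂ (nam φ M) = cong (nam φ) (redirect-structT² r h e₁ e₂ M)
redirect-structT² {σ} {τ} {j} {k} r h e₁ e₂ (nam (mv n) M) with isIdx (mv n) k in ek
... | true  rewrite trans (tracks r n) ek | trans (tracks r n) ek =
  cong₂ nam (target r n ek)
            (cong₂ app (cong₂ app (redirect-structT² r h e₁ e₂ M) (trans (cong (renMt σ) h) e₁)) e₂)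
... | false rewrite trans (tracks r n) ek | trans (tracks r n) ek =
  cong₂ nam (others r n ek) (redirect-structT² r h e₁ e₂ M)

redirect₀ : Redirects (inst0 φ) (extM shM) 0 0
redirect₀ = record { tracks = tracks₀ ; others = others₀ ; target = target₀ }
  where
  tracks₀ : MapsIdx (extM shM) 0 0
  tracks₀ zero    = refl
  tracks₀ (suc n) = refl
  others₀ : ∀ n → isIdx (mv n) 0 ≡ false → mapMN (inst0 φ) (extM shM n) ≡ mv n
  others₀ zero    ()
  others₀ (suc n) _ = refl
  target₀ : ∀ n → isIdx (mv n) 0 ≡ true → mapMN (inst0 φ) (extM shM n) ≡ φ
  target₀ zero    _ = refl
  target₀ (suc n) ()

projTm-mu : ∀ K Z → projTm (renMt shM (mu Z)) K ▷⁺βμ mu (replace₁ 0 K Z)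
projTm-mu K Z =
  βμ-then (inj₂ (onμ (muC ∘C namC φ) (μ-step (renMt (extM shM) Z) K)))
          (ρ⊆ (onρ muC (reduct-≡ _▷ρ_ (ρ-step φ _) (redirect-structT redirect₀ (renMt-inst0-shM φ K) Z))) ◅ ε)

caseTm-mu : ∀ Z W₁ W₂ → caseTm (renMt shM (mu Z)) (nam (mv 1) (renMt shM₂ W₁)) (nam (mv 1) (renMt shM₂ W₂))
                        ▷⁺βμ mu (replace₂ 0 (branch W₁) (branch W₂) Z)
caseTm-mu Z W₁ W₂ =
  βμ-then (inj₂ (onμ (muC ∘C namC φ ∘C appˡC (branch W₂)) (μ-step (renMt (extM shM) Z) (branch W₁))))
          (μ⊆ (onμ (muC ∘C namC φ) (μ-step _ (branch W₂))) ◅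
           ρ⊆ (onρ muC (reduct-≡ _▷ρ_ (ρ-step φ _)
                          (redirect-structT² redirect₀ branch₁-fresh
                             (renMt-inst0-shM φ (branch W₁)) (renMt-inst0-shM φ (branch W₂)) Z))) ◅ ε)
  where
  shM₂-then-extM : ∀ W → renMt (extM shM) (renMt shM₂ W) ≡ renMt shM₃ W
  shM₂-then-extM = renMt-fusion (λ _ → refl)
  branch₁-fresh : structT 0 (renMt shM (branch W₂)) (renMt shM (branch W₁)) ≡ renMt shM (branch W₁)
  branch₁-fresh = cong (λ Y → lam (mu (nam (mv 2) Y)))
    (trans (cong (structT 1 _) (shM₂-then-extM W₁))
           (trans (structT-fresh (λ _ → refl) W₁) (sym (shM₂-then-extM W₁))))

on*ρ-app : ∀ {A A' B B'} → A ▷*ρ A' → B ▷*ρ B' → app A B ▷*ρ app A' B'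
on*ρ-app {A' = A'} {B = B} a b = on*ρ (appˡC B) a ◅◅ on*ρ (appʳC A') b

on*ρ-pairTm : ∀ {A A' B B'} → A ▷*ρ A' → B ▷*ρ B' → pairTm A B ▷*ρ pairTm A' B'
on*ρ-pairTm {A' = A'} {B = B} a b =
  on*ρ (lamC ∘C appˡC B ∘C appʳC (var 0)) a ◅◅ on*ρ (lamC ∘C appʳC (app (var 0) A')) b

on*ρ-projTm : ∀ {A A' K} → A ▷*ρ A' → projTm A K ▷*ρ projTm A' K
on*ρ-projTm {K = K} = on*ρ (muC ∘C namC φ ∘C appˡC K)

on*ρ-caseTm : ∀ {A A' Z₁ Z₁' Z₂ Z₂'} → A ▷*ρ A' → Z₁ ▷*ρ Z₁' → Z₂ ▷*ρ Z₂' →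
              caseTm A Z₁ Z₂ ▷*ρ caseTm A' Z₁' Z₂'
on*ρ-caseTm {A' = A'} {Z₁} {Z₁'} {Z₂} a z₁ z₂ =
  on*ρ (muC ∘C namC φ ∘C appˡC (lam (mu Z₂)) ∘C appˡC (lam (mu Z₁))) a ◅◅
  on*ρ (muC ∘C namC φ ∘C appˡC (lam (mu Z₂)) ∘C appʳC A' ∘C lamC ∘C muC) z₁ ◅◅
  on*ρ (muC ∘C namC φ ∘C appʳC (app A' (lam (mu Z₁'))) ∘C lamC ∘C muC) z₂

projKTo : ℕ → ℕ → Tm
projKTo x k = lam (lam (mu (nam (mv (suc k)) (var x))))

data IsProj : Elim → ℕ → Set where
  first  : IsProj π₁ 1
  second : IsProj π₂ 0

IsProj-renTE : ∀ {e x} → IsProj e x → ∀ ρ → renTE ρ e ≡ e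
IsProj-renTE first  ρ = refl
IsProj-renTE second ρ = refl

IsProj-renME : ∀ {e x} → IsProj e x → ∀ σ → renME σ e ≡ e
IsProj-renME first  σ = refl
IsProj-renME second σ = refl

IsProj-ext² : ∀ {e x} → IsProj e x → ∀ ρ → ext (ext ρ) x ≡ x
IsProj-ext² first  ρ = refl
IsProj-ext² second ρ = refl

IsProj-° : ∀ {e x} → IsProj e x → ∀ L → app L e ° ≡ projTm (renMt shM (L °)) (projK x)
IsProj-° first  L = refl
IsProj-° second L = refl

isIdx-true : ∀ {n k} → isIdx (mv n) k ≡ true → n ≡ k
isIdx-true {n} {k} e = ≡ᵇ⇒≡ n k (subst T (sym e) tt)

°-structS-proj : ∀ {e x} → IsProj e x → ∀ k M → structS k e M ° ▷*ρ replace₁ k (projKTo x k) (M °)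

°-structS-proj-renMt : ∀ {e x} → IsProj e x → ∀ {κ k k'} → MapsIdx κ k k' →
                       ∀ M → renMt κ (structS k e M °) ▷*ρ replace₁ k' (renMt κ (projKTo x k)) (renMt κ (M °))
°-structS-proj-renMt p {κ} {k} h M =
  reduct-≡ _▷*ρ_ (on*ρ (renMtC κ) (°-structS-proj p k M)) (replace₁-renMt h refl (M °))

°-structS-proj-renTt : ∀ {e x} → IsProj e x → ∀ κ k M →
                       renTt κ (structS k e M °) ▷*ρ replace₁ k (projKTo x k) (renTt κ (M °))
°-structS-proj-renTt p κ k M =
  reduct-≡ _▷*ρ_ (on*ρ (renTtC κ) (°-structS-proj p k M))
    (replace₁-renTt (cong (λ y → lam (lam (mu (nam (mv (suc k)) (var y))))) (sym (IsProj-ext² p κ))) (M °))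

°-structS-proj p k (var x) = ε
°-structS-proj p k (lam M) rewrite IsProj-renTE p suc | IsProj-ext² p suc =
  on*ρ lamC (°-structS-proj p k M)
°-structS-proj p k (app M (arg N)) = on*ρ-app (°-structS-proj p k M) (°-structS-proj p k N)
°-structS-proj p k (app M π₁) = on*ρ-projTm (°-structS-proj-renMt p (λ _ → refl) M)
°-structS-proj p k (app M π₂) = on*ρ-projTm (°-structS-proj-renMt p (λ _ → refl) M)
°-structS-proj p k (app M (case N₁ N₂)) rewrite IsProj-renTE p suc | IsProj-ext² p suc =
  on*ρ-caseTm (°-structS-proj-renMt p (λ _ → refl) M)
              (on*ρ (namC (mv 1)) (°-structS-proj-renMt p (λ _ → refl) N₁))
              (on*ρ (namC (mv 1)) (°-structS-proj-renMt p (λ _ → refl) N₂))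
°-structS-proj p k (pair M N) rewrite IsProj-ext² p suc =
  on*ρ-pairTm (°-structS-proj-renTt p suc k M) (°-structS-proj-renTt p suc k N)
°-structS-proj p k (ω₁ M) rewrite IsProj-ext² p suc | IsProj-ext² p suc =
  on*ρ (lamC ∘C lamC ∘C appʳC (var 1)) (°-structS-proj-renTt p wk₂ k M)
°-structS-proj p k (ω₂ M) rewrite IsProj-ext² p suc | IsProj-ext² p suc =
  on*ρ (lamC ∘C lamC ∘C appʳC (var 0)) (°-structS-proj-renTt p wk₂ k M)
°-structS-proj p k (mu M) rewrite IsProj-renME p shM = on*ρ muC (°-structS-proj p (suc k) M)
°-structS-proj p k (nam φ M) = on*ρ (namC φ) (°-structS-proj p k M)
°-structS-proj {e} p k (nam (mv n) M) with isIdx (mv n) k in ek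
... | false = on*ρ (namC (mv n)) (°-structS-proj p k M)
... | true with isIdx-true {n} ek
... | refl =
  redex-≡ _▷*ρ_ (cong (nam (mv k)) (IsProj-° p (structS k e M)))
    (ρ-step (mv k) _ ◅ redex-≡ _▷*ρ_ (cong (λ Y → nam φ (app Y _)) (renMt-inst0-shM (mv k) _))
                                    (on*ρ (namC φ ∘C appˡC _) (°-structS-proj p k M)))

branchTo : ℕ → Term → Tm
branchTo k N = lam (mu (nam (mv (suc k)) (renMt shM (N °))))

branchTo-renT : ∀ k N → branchTo k (renT (ext suc) N) ≡ renTt suc (branchTo k N)
branchTo-renT k N = cong (λ Y → lam (mu (nam (mv (suc k)) Y))) (°-renT-renMt (ext suc) shM N)

branchTo-renM : ∀ k N → branchTo (suc k) (renM shM N) ≡ renMt shM (branchTo k N)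
branchTo-renM k N = cong (λ Y → lam (mu (nam (mv (suc (suc k))) Y))) (°-renM-renMt shM (λ _ → refl) N)

°-structS-case : ∀ k N₁ N₂ M →
                 structS k (case N₁ N₂) M ° ▷*ρ replace₂ k (branchTo k N₁) (branchTo k N₂) (M °)

°-structS-case-renMt : ∀ {κ k k' N₁ N₂ K₁ K₂} → MapsIdx κ k k' →
                       K₁ ≡ renMt κ (branchTo k N₁) → K₂ ≡ renMt κ (branchTo k N₂) →
                       ∀ M → renMt κ (structS k (case N₁ N₂) M °) ▷*ρ replace₂ k' K₁ K₂ (renMt κ (M °))
°-structS-case-renMt {κ} {k} {N₁ = N₁} {N₂} h e₁ e₂ M =
  reduct-≡ _▷*ρ_ (on*ρ (renMtC κ) (°-structS-case k N₁ N₂ M)) (replace₂-renMt h e₁ e₂ (M °))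

°-structS-case-renTt : ∀ {κ k N₁ N₂ K₁ K₂} →
                       K₁ ≡ renTt κ (branchTo k N₁) → K₂ ≡ renTt κ (branchTo k N₂) →
                       ∀ M → renTt κ (structS k (case N₁ N₂) M °) ▷*ρ replace₂ k K₁ K₂ (renTt κ (M °))
°-structS-case-renTt {κ} {k} {N₁} {N₂} e₁ e₂ M =
  reduct-≡ _▷*ρ_ (on*ρ (renTtC κ) (°-structS-case k N₁ N₂ M)) (replace₂-renTt e₁ e₂ (M °))

°-structS-case k N₁ N₂ (var x) = ε
°-structS-case k N₁ N₂ (lam M) =
  reduct-≡ _▷*ρ_ (on*ρ lamC (°-structS-case k _ _ M))
    (cong lam (cong₂ (λ K₁ K₂ → replace₂ k K₁ K₂ (M °)) (branchTo-renT k N₁) (branchTo-renT k N₂)))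
°-structS-case k N₁ N₂ (app M (arg N)) = on*ρ-app (°-structS-case k N₁ N₂ M) (°-structS-case k N₁ N₂ N)
°-structS-case k N₁ N₂ (app M π₁) = on*ρ-projTm (°-structS-case-renMt (λ _ → refl) refl refl M)
°-structS-case k N₁ N₂ (app M π₂) = on*ρ-projTm (°-structS-case-renMt (λ _ → refl) refl refl M)
°-structS-case k N₁ N₂ (app M (case C₁ C₂)) =
  on*ρ-caseTm (°-structS-case-renMt (λ _ → refl) refl refl M)
              (on*ρ (namC (mv 1)) (°-structS-case-renMt (λ _ → refl) (shifted N₁) (shifted N₂) C₁))
              (on*ρ (namC (mv 1)) (°-structS-case-renMt (λ _ → refl) (shifted N₁) (shifted N₂) C₂))
  where
  shifted : ∀ N → renMt shM (renTt suc (renMt shM (branchTo k N)))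
                  ≡ renMt shM₂ (branchTo k (renT (ext suc) N))
  shifted N = trans (renMt-renTt-shM (branchTo k N)) (cong (renMt shM₂) (sym (branchTo-renT k N)))
°-structS-case k N₁ N₂ (pair M N) =
  on*ρ-pairTm (°-structS-case-renTt refl refl M) (°-structS-case-renTt refl refl N)
°-structS-case k N₁ N₂ (ω₁ M) =
  on*ρ (lamC ∘C lamC ∘C appʳC (var 1))
       (°-structS-case-renTt (renTt-fusion (λ _ → refl) _) (renTt-fusion (λ _ → refl) _) M)
°-structS-case k N₁ N₂ (ω₂ M) =
  on*ρ (lamC ∘C lamC ∘C appʳC (var 0))
       (°-structS-case-renTt (renTt-fusion (λ _ → refl) _) (renTt-fusion (λ _ → refl) _) M)
°-structS-case k N₁ N₂ (mu M) =
  reduct-≡ _▷*ρ_ (on*ρ muC (°-structS-case (suc k) _ _ M))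
    (cong mu (cong₂ (λ K₁ K₂ → replace₂ (suc k) K₁ K₂ (M °)) (branchTo-renM k N₁) (branchTo-renM k N₂)))
°-structS-case k N₁ N₂ (nam φ M) = on*ρ (namC φ) (°-structS-case k N₁ N₂ M)
°-structS-case k N₁ N₂ (nam (mv n) M) with isIdx (mv n) k in ek
... | false = on*ρ (namC (mv n)) (°-structS-case k N₁ N₂ M)
... | true with isIdx-true {n} ek
... | refl =
  ρ-step (mv k) _ ◅ redex-≡ _▷*ρ_ (cong₃ (λ X K₁ K₂ → nam φ (app (app X K₁) K₂))
                                         (renMt-inst0-shM (mv k) _) (unshift N₁) (unshift N₂))
                                  (on*ρ (namC φ ∘C appˡC _ ∘C appˡC _) (°-structS-case k N₁ N₂ M))
  where
  unshift : ∀ N → lam (mu (nam (mv (suc k)) (renMt (extM (inst0 (mv k))) (renMt shM₂ (N °))))) ≡ branchTo k N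
  unshift N = cong (λ Y → lam (mu (nam (mv (suc k)) Y))) (renMt-fusion (λ _ → refl) (N °))

-- Simulation of the reduction rules

Simulated : Term → Term → Set
Simulated M N = Σ Tm (λ P → (M ° ▷⁺βμ P) × (N ° ▷*ρ P))

°-sub0 : ∀ N n → sub0 N n ° ≡ sub0t (N °) n
°-sub0 N zero    = refl
°-sub0 N (suc n) = refl

simulate-β : ∀ M N → Simulated (app (lam M) (arg N)) (M [0:= N ])
simulate-β M N = _ , βμ-then (inj₁ (reduct-≡ _▷β_ (β-step (M °) (N °)) (sym (°-subT (°-sub0 N) M)))) ε , ε

simulate-μ-arg : ∀ M L → Simulated (app (mu M) (arg L)) (mu (structS 0 (renME shM (arg L)) M))
simulate-μ-arg M L =
  _ , βμ-then (inj₂ (reduct-≡ _▷μ_ (μ-step (M °) (L °)) (cong mu (sym shifted)))) ε , ε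
  where
  shifted : structS 0 (arg (renM shM L)) M ° ≡ structT 0 (renMt shM (L °)) (M °)
  shifted = trans (°-structS 0 (renM shM L) M) (cong (λ Y → structT 0 Y (M °)) (°-renM shM L))

simulate-μ-proj : ∀ {e x} → IsProj e x → ∀ M → Simulated (app (mu M) e) (mu (structS 0 (renME shM e) M))
simulate-μ-proj {x = x} p M rewrite IsProj-renME p shM | IsProj-° p (mu M) =
  _ , projTm-mu (projK x) (M °) , on*ρ muC (°-structS-proj p 0 M)

simulate-μ-case : ∀ M N₁ N₂ → Simulated (app (mu M) (case N₁ N₂)) (mu (structS 0 (renME shM (case N₁ N₂)) M))
simulate-μ-case M N₁ N₂ =
  _ , caseTm-mu (M °) (N₁ °) (N₂ °) ,
  reduct-≡ _▷*ρ_ (on*ρ muC (°-structS-case 0 (renM shM N₁) (renM shM N₂) M))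
    (cong mu (cong₂ (λ K₁ K₂ → replace₂ 0 K₁ K₂ (M °)) (branchTo₀ N₁) (branchTo₀ N₂)))
  where
  branchTo₀ : ∀ N → branchTo 0 (renM shM N) ≡ branch (N °)
  branchTo₀ N = cong (λ Y → lam (mu (nam (mv 1) Y)))
    (trans (cong (renMt shM) (°-renM shM N)) (renMt-fusion (λ _ → refl) (N °)))

-- μα.(φ μγ.(α M)) ▷ρ μα.(α M) ▷θ M: how a translated elimination hands back its result.
mu-φ-mu : ∀ M → mu (nam φ (mu (nam (mv 1) (renMt shM₂ M)))) ▷*βμρθ M
mu-φ-mu M =
  ρ⊆ (onρ muC (reduct-≡ _▷ρ_ (ρ-step φ _) (cong (nam (mv 0)) (renMt-fusion (λ _ → refl) M)))) ◅
  θ⊆ (θ-step M) ◅ ε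

pairTm-β : ∀ K A B → app (renMt shM (pairTm (renTt suc A) (renTt suc B))) K
                     ▷β app (app K (renMt shM A)) (renMt shM B)
pairTm-β K A B = reduct-≡ _▷β_ (β-step _ K) (cong₂ (λ X Y → app (app K X) Y) (unweaken A) (unweaken B))
  where
  unweaken : ∀ X → subTt (sub0t K) (renMt shM (renTt suc X)) ≡ renMt shM X
  unweaken X = trans (cong (subTt (sub0t K)) (sym (renTt-renMt-comm suc shM X)))
                     (subTt-sub0t-weaken K (renMt shM X))

simulate-π₁ : ∀ M₁ M₂ → Simulated (app (pair M₁ M₂) π₁) M₁
simulate-π₁ M₁ M₂ =
  _ , βμ-then (inj₁ (onβ (muC ∘C namC φ) (pairTm-β (projK 1) (M₁ °) (M₂ °))))
              (β⊆ (onβ (muC ∘C namC φ ∘C appˡC B₂) (β-step _ B₁)) ◅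
               β⊆ (onβ (muC ∘C namC φ) take-B₂) ◅ mu-φ-mu (M₁ °)) , ε
  where
  B₁ B₂ : Tm
  B₁ = renMt shM (M₁ °)
  B₂ = renMt shM (M₂ °)
  take-B₂ : app (lam (mu (nam (mv 1) (renMt shM (renTt suc B₁))))) B₂ ▷β mu (nam (mv 1) (renMt shM₂ (M₁ °)))
  take-B₂ = reduct-≡ _▷β_ (β-step _ B₂) (cong (λ Y → mu (nam (mv 1) Y))
    (trans (subTt-renMt (λ _ → refl) (renTt suc B₁))
           (trans (cong (renMt shM) (subTt-sub0t-weaken B₂ B₁)) (renMt-fusion (λ _ → refl) (M₁ °)))))

simulate-π₂ : ∀ M₁ M₂ → Simulated (app (pair M₁ M₂) π₂) M₂
simulate-π₂ M₁ M₂ =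
  _ , βμ-then (inj₁ (onβ (muC ∘C namC φ) (pairTm-β (projK 0) (M₁ °) (M₂ °))))
              (β⊆ (onβ (muC ∘C namC φ ∘C appˡC B₂) (β-step _ B₁)) ◅
               β⊆ (onβ (muC ∘C namC φ) take-B₂) ◅ mu-φ-mu (M₂ °)) , ε
  where
  B₁ B₂ : Tm
  B₁ = renMt shM (M₁ °)
  B₂ = renMt shM (M₂ °)
  take-B₂ : app (lam (mu (nam (mv 1) (var 0)))) B₂ ▷β mu (nam (mv 1) (renMt shM₂ (M₂ °)))
  take-B₂ = reduct-≡ _▷β_ (β-step _ B₂) (cong (λ Y → mu (nam (mv 1) Y)) (renMt-fusion (λ _ → refl) (M₂ °)))

branch-β : ∀ M N → mu (nam φ (app (branch N) (renMt shM M))) ▷*βμρθ subTt (sub0t M) N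
branch-β M N =
  β⊆ (onβ (muC ∘C namC φ) (reduct-≡ _▷β_ (β-step _ (renMt shM M))
                                         (cong (λ Y → mu (nam (mv 1) Y)) (subTt-renMt shift-sub0t N)))) ◅
  mu-φ-mu (subTt (sub0t M) N)
  where
  shift-sub0t : ∀ n → renMt shM (sub0t (renMt shM M) n) ≡ renMt shM₂ (sub0t M n)
  shift-sub0t zero    = renMt-fusion (λ _ → refl) M
  shift-sub0t (suc n) = refl

ω-body : ∀ B M → subTt (extst (sub0t B)) (renMt shM (renTt wk₂ M)) ≡ renTt suc (renMt shM M)
ω-body B M =
  trans (cong (subTt (extst (sub0t B))) (sym (renTt-renMt-comm wk₂ shM M)))
        (trans (subTt-renTt {τ = λ n → var (suc n)} (λ _ → refl) (renMt shM M))
               (subTt-renaming (λ _ → refl) (renMt shM M)))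

simulate-ω₁ : ∀ M N₁ N₂ → Simulated (app (ω₁ M) (case N₁ N₂)) (N₁ [0:= M ])
simulate-ω₁ M N₁ N₂ =
  _ , βμ-then (inj₁ (onβ (muC ∘C namC φ ∘C appˡC B₂) take-B₁))
              (β⊆ (onβ (muC ∘C namC φ) take-B₂) ◅ branch-β (M °) (N₁ °)) ,
  reduct-≡ _▷*ρ_ ε (°-subT (°-sub0 M) N₁)
  where
  B₁ B₂ Y : Tm
  B₁ = branch (N₁ °)
  B₂ = branch (N₂ °)
  Y  = renMt shM (M °)
  take-B₁ : app (renMt shM (ω₁ M °)) B₁ ▷β lam (app (renTt suc B₁) (renTt suc Y))
  take-B₁ = reduct-≡ _▷β_ (β-step _ B₁) (cong (λ Z → lam (app (renTt suc B₁) Z)) (ω-body B₁ (M °)))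
  take-B₂ : app (lam (app (renTt suc B₁) (renTt suc Y))) B₂ ▷β app B₁ Y
  take-B₂ = reduct-≡ _▷β_ (β-step _ B₂) (cong₂ app (subTt-sub0t-weaken B₂ B₁) (subTt-sub0t-weaken B₂ Y))

simulate-ω₂ : ∀ M N₁ N₂ → Simulated (app (ω₂ M) (case N₁ N₂)) (N₂ [0:= M ])
simulate-ω₂ M N₁ N₂ =
  _ , βμ-then (inj₁ (onβ (muC ∘C namC φ ∘C appˡC B₂) take-B₁))
              (β⊆ (onβ (muC ∘C namC φ) take-B₂) ◅ branch-β (M °) (N₂ °)) ,
  reduct-≡ _▷*ρ_ ε (°-subT (°-sub0 M) N₂)
  where
  B₁ B₂ Y : Tm
  B₁ = branch (N₁ °)
  B₂ = branch (N₂ °)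
  Y  = renMt shM (M °)
  take-B₁ : app (renMt shM (ω₂ M °)) B₁ ▷β lam (app (var 0) (renTt suc Y))
  take-B₁ = reduct-≡ _▷β_ (β-step _ B₁) (cong (λ Z → lam (app (var 0) Z)) (ω-body B₁ (M °)))
  take-B₂ : app (lam (app (var 0) (renTt suc Y))) B₂ ▷β app B₂ Y
  take-B₂ = reduct-≡ _▷β_ (β-step _ B₂) (cong (app B₂) (subTt-sub0t-weaken B₂ Y))

caseScope : Term → Term → Term → Tm
caseScope M N₁ N₂ = nam φ (app (app (renMt shM (M °)) (branch (N₁ °))) (branch (N₂ °)))

on*ρ-branches : ∀ {X Z₁ Z₁' Z₂ Z₂'} → Z₁ ▷ρ Z₁' → Z₂ ▷ρ Z₂' → caseTm X Z₁ Z₂ ▷*ρ caseTm X Z₁' Z₂'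
on*ρ-branches r₁ r₂ = on*ρ-caseTm ε (r₁ ◅ ε) (r₂ ◅ ε)

simulate-comm-arg : ∀ M N₁ N₂ L →
  Simulated (app (app M (case N₁ N₂)) (arg L))
            (app M (case (app N₁ (arg (renT suc L))) (app N₂ (arg (renT suc L)))))
simulate-comm-arg M N₁ N₂ L =
  _ , βμ-then (inj₂ (reduct-≡ _▷μ_ (μ-step (caseScope M N₁ N₂) (L °)) (cong mu pushed))) ε , ε
  where
  shifted-L : renMt shM (renTt suc (renMt shM (L °))) ≡ renMt shM₂ (renT suc L °)
  shifted-L = trans (renMt-renTt-shM (L °)) (cong (renMt shM₂) (sym (°-renT suc L)))
  pushed : structT 0 (renMt shM (L °)) (caseScope M N₁ N₂)
           ≡ caseScope M (app N₁ (arg (renT suc L))) (app N₂ (arg (renT suc L)))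
  pushed = cong₃ (λ X Y₁ Y₂ → nam φ (app (app X (lam (mu (nam (mv 1) Y₁)))) (lam (mu (nam (mv 1) Y₂)))))
                 (structT-fresh (λ _ → refl) (M °))
                 (cong₂ app (structT-fresh (λ _ → refl) (N₁ °)) shifted-L)
                 (cong₂ app (structT-fresh (λ _ → refl) (N₂ °)) shifted-L)

ρ-branch : ∀ W → renMt (inst0 (mv 1)) (renMt (extM shM₂) (renMt shM W)) ≡ renMt shM₂ W
ρ-branch W = trans (cong (renMt (inst0 (mv 1))) (renMt-fusion {υ = shM₃} (λ _ → refl) W))
                   (renMt-fusion (λ _ → refl) W)

simulate-comm-proj : ∀ {e x} → IsProj e x → ∀ M N₁ N₂ →
  Simulated (app (app M (case N₁ N₂)) e) (app M (case (app N₁ e) (app N₂ e)))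
simulate-comm-proj {x = x} p M N₁ N₂
  rewrite IsProj-° p (app M (case N₁ N₂)) | IsProj-° p N₁ | IsProj-° p N₂ =
  _ , reduct-≡ _▷⁺βμ_ (projTm-mu (projK x) (caseScope M N₁ N₂))
        (cong₃ caseTm (replace₁-fresh (λ _ → refl) (M °)) (throw-fresh N₁) (throw-fresh N₂)) ,
  on*ρ-branches (reduct-≡ _▷ρ_ (ρ-step (mv 1) _) (throw-ρ N₁)) (reduct-≡ _▷ρ_ (ρ-step (mv 1) _) (throw-ρ N₂))
  where
  throw : Tm → Tm
  throw W = nam φ (app (renMt shM₂ W) (projKTo x 1))
  K : Tm
  K = renMt shM (renTt suc (projK x))
  throw-fresh : ∀ N → replace₁ 1 K (nam (mv 1) (renMt shM₂ (N °))) ≡ throw (N °)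
  throw-fresh N = cong₂ (λ Y K → nam φ (app Y K)) (replace₁-fresh (λ _ → refl) (N °))
                        (cong (λ y → lam (lam (mu (nam (mv 2) (var y))))) (IsProj-ext² p suc))
  throw-ρ : ∀ N → renMt (inst0 (mv 1)) (renMt (extM shM₂) (nam φ (app (renMt shM (N °)) (projK x))))
                  ≡ throw (N °)
  throw-ρ N = cong (λ Y → nam φ (app Y (projKTo x 1))) (ρ-branch (N °))

simulate-comm-case : ∀ M N₁ N₂ L₁ L₂ →
  Simulated (app (app M (case N₁ N₂)) (case L₁ L₂))
            (app M (case (app N₁ (case (renT (ext suc) L₁) (renT (ext suc) L₂)))
                         (app N₂ (case (renT (ext suc) L₁) (renT (ext suc) L₂)))))
simulate-comm-case M N₁ N₂ L₁ L₂ =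
  _ , reduct-≡ _▷⁺βμ_ (caseTm-mu (caseScope M N₁ N₂) (L₁ °) (L₂ °))
        (cong₃ caseTm (replace₂-fresh (λ _ → refl) (M °)) (throw-fresh N₁) (throw-fresh N₂)) ,
  on*ρ-branches (reduct-≡ _▷ρ_ (ρ-step (mv 1) _) (throw-ρ N₁)) (reduct-≡ _▷ρ_ (ρ-step (mv 1) _) (throw-ρ N₂))
  where
  inner : Term → Tm
  inner L = lam (mu (nam (mv 2) (renMt shM₃ (renTt (ext suc) (L °)))))
  throw : Tm → Tm
  throw W = nam φ (app (app (renMt shM₂ W) (inner L₁)) (inner L₂))
  shifted-branch : ∀ L → renMt shM (renTt suc (branch (L °))) ≡ inner L
  shifted-branch L = cong (λ Y → lam (mu (nam (mv 2) Y)))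
    (trans (cong (renMt (extM shM)) (renTt-renMt-comm (ext suc) shM₂ (L °))) (renMt-fusion (λ _ → refl) _))
  K₁ K₂ : Tm
  K₁ = renMt shM (renTt suc (branch (L₁ °)))
  K₂ = renMt shM (renTt suc (branch (L₂ °)))
  throw-fresh : ∀ N → replace₂ 1 K₁ K₂ (nam (mv 1) (renMt shM₂ (N °))) ≡ throw (N °)
  throw-fresh N = cong₃ (λ X A B → nam φ (app (app X A) B))
                        (replace₂-fresh (λ _ → refl) (N °)) (shifted-branch L₁) (shifted-branch L₂)
  ρ-inner : ∀ L → renMt (extM (inst0 (mv 1))) (renMt (extM (extM shM₂)) (renMt shM₂ (renT (ext suc) L °)))
                  ≡ renMt shM₃ (renTt (ext suc) (L °))
  ρ-inner L = trans (cong (renMt (extM (inst0 (mv 1)))) (renMt-fusion {υ = shM₄} (λ _ → refl) _))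
                    (trans (renMt-fusion (λ _ → refl) _) (cong (renMt shM₃) (°-renT (ext suc) L)))
  throw-ρ : ∀ N → renMt (inst0 (mv 1))
                    (renMt (extM shM₂) (caseScope N (renT (ext suc) L₁) (renT (ext suc) L₂)))
                  ≡ throw (N °)
  throw-ρ N = cong₃ (λ X Y₁ Y₂ → nam φ (app (app X (lam (mu (nam (mv 2) Y₁)))) (lam (mu (nam (mv 2) Y₂)))))
                    (ρ-branch (N °)) (ρ-inner L₁) (ρ-inner L₂)

simulate-rule : ∀ {M N} → Rule M N → Simulated M N
simulate-rule (r-β M N)                  = simulate-β M N
simulate-rule (r-μ M (arg L))            = simulate-μ-arg M L
simulate-rule (r-μ M π₁)                 = simulate-μ-proj first M
simulate-rule (r-μ M π₂)                 = simulate-μ-proj second M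
simulate-rule (r-μ M (case N₁ N₂))       = simulate-μ-case M N₁ N₂
simulate-rule (r-π₁ M₁ M₂)               = simulate-π₁ M₁ M₂
simulate-rule (r-π₂ M₁ M₂)               = simulate-π₂ M₁ M₂
simulate-rule (r-ω₁ M N₁ N₂)             = simulate-ω₁ M N₁ N₂
simulate-rule (r-ω₂ M N₁ N₂)             = simulate-ω₂ M N₁ N₂
simulate-rule (r-comm M N₁ N₂ (arg L))   = simulate-comm-arg M N₁ N₂ L
simulate-rule (r-comm M N₁ N₂ π₁)        = simulate-comm-proj first M N₁ N₂
simulate-rule (r-comm M N₁ N₂ π₂)        = simulate-comm-proj second M N₁ N₂
simulate-rule (r-comm M N₁ N₂ (case L₁ L₂)) = simulate-comm-case M N₁ N₂ L₁ L₂

simulated-under : ∀ {f M N} → Compatible f → Simulated M N → Σ Tm (λ P → (f (M °) ▷⁺βμ P) × (f (N °) ▷*ρ P))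
simulated-under C (P , source , target) = _ , on⁺βμ C source , on*ρ C target

simulation : ∀ {M N} → M ▷ N → Simulated M N
simulation (base r)                 = simulate-rule r
simulation (c-lam s)                = simulated-under lamC (simulation s)
simulation (c-appˡ {e = arg L} s)   = simulated-under (appˡC (L °)) (simulation s)
simulation (c-appˡ {e = π₁} s)      =
  simulated-under (muC ∘C namC φ ∘C appˡC (projK 1) ∘C renMtC shM) (simulation s)
simulation (c-appˡ {e = π₂} s)      =
  simulated-under (muC ∘C namC φ ∘C appˡC (projK 0) ∘C renMtC shM) (simulation s)
simulation (c-appˡ {e = case N₁ N₂} s) =
  simulated-under (muC ∘C namC φ ∘C appˡC (branch (N₂ °)) ∘C appˡC (branch (N₁ °)) ∘C renMtC shM)
                  (simulation s)
simulation (c-appʳ {M} (c-arg s))   = simulated-under (appʳC (M °)) (simulation s)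
simulation (c-appʳ {M} (c-caseˡ {N₂ = N₂} s)) =
  simulated-under (muC ∘C namC φ ∘C appˡC (branch (N₂ °)) ∘C appʳC (renMt shM (M °)) ∘C
                   lamC ∘C muC ∘C namC (mv 1) ∘C renMtC shM₂) (simulation s)
simulation (c-appʳ {M} (c-caseʳ {N₁ = N₁} s)) =
  simulated-under (muC ∘C namC φ ∘C appʳC (app (renMt shM (M °)) (branch (N₁ °))) ∘C
                   lamC ∘C muC ∘C namC (mv 1) ∘C renMtC shM₂) (simulation s)
simulation (c-pairˡ {N = N} s)      =
  simulated-under (lamC ∘C appˡC (renTt suc (N °)) ∘C appʳC (var 0) ∘C renTtC suc) (simulation s)
simulation (c-pairʳ {M = M} s)      =
  simulated-under (lamC ∘C appʳC (app (var 0) (renTt suc (M °))) ∘C renTtC suc) (simulation s)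
simulation (c-ω₁ s)                 =
  simulated-under (lamC ∘C lamC ∘C appʳC (var 1) ∘C renTtC wk₂) (simulation s)
simulation (c-ω₂ s)                 =
  simulated-under (lamC ∘C lamC ∘C appʳC (var 0) ∘C renTtC wk₂) (simulation s)
simulation (c-mu s)                 = simulated-under muC (simulation s)
simulation (c-nam s)                = simulated-under (namC _) (simulation s)

lemma6p6 : (M N : Term) → M ▷ N →
    Σ Tm (λ P → (M ° ▷⁺βμ P) × (N ° ▷*ρ P))
lemma6p6 M N s = simulation s
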